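{- For every $w\in S_n$, the chromatic polynomial of the inversion graph $G_w$ satisfies $$\chi_{G_w}(t)=\sum_{i=0}^{n} r_{n-i}(O_w)\,t(t-1)\cdots(t-i+1),$$ where $r_k(O_w)$ is the number of placements of $k$ non-attacking rooks on $O_w$.
   Context: For $w=w_1\cdots w_n\in S_n$, the inversion graph $G_w$ has vertex set $[n]$ and edges $\{i,j\}$ for $i<j$ with $w_i>w_j$. The south-west diagram is $O_w=\{(i,w_j):1\le i<j\le n,\ w_j>w_i\}\subseteq[n]\times[n]$. A placement of $k$ non-attacking rooks on $O_w$ is a set of $k$ cells of $O_w$ no two in the same row or column ($r_0=1$). The product $t(t-1)\cdots(t-i+1)$ is $1$ for $i=0$. $\chi_G(t)$ is the chromatic polynomial of $G$. -}

module Defs where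

open import Data.Nat using (ℕ; zero; suc; _+_; _*_; _∸_)
open import Data.Bool using (Bool; true; false; _∧_; _∨_; not; if_then_else_)
open import Data.Fin using (Fin; _<?_; _≟_)
open import Data.Fin.Permutation using (Permutation′; _⟨$⟩ʳ_)
open import Data.List using (List; []; _∷_; map; concatMap; allFin; filterᵇ; length)
open import Data.Bool.ListAction using (all; any)
open import Data.Nat.ListAction using (sum)
open import Data.Vec using (Vec; []; _∷_; lookup)
open import Data.Nat.Properties using () renaming (_≟_ to _≟ℕ_)
open import Relation.Nullary.Decidable using (⌊_⌋)

-- Permutations w ∈ S_n, as bijections of Fin n (positions 0..n-1 stand for 1..n).
Perm : ℕ → Set
Perm n = Permutation′ n

_<ᵇ_ : ∀ {n} → Fin n → Fin n → Bool
i <ᵇ j = ⌊ i <? j ⌋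

_≡ᵇ_ : ∀ {n} → Fin n → Fin n → Bool
i ≡ᵇ j = ⌊ i ≟ j ⌋

invEdge : ∀ {n} → Perm n → Fin n → Fin n → Bool
invEdge w i j = (i <ᵇ j) ∧ ((w ⟨$⟩ʳ j) <ᵇ (w ⟨$⟩ʳ i))

allVecs : ∀ {A : Set} → List A → (n : ℕ) → List (Vec A n)
allVecs xs zero = [] ∷ []
allVecs xs (suc n) = concatMap (λ x → map (x ∷_) (allVecs xs n)) xs

isProper : ∀ {n t} → Perm n → Vec (Fin t) n → Bool
isProper {n} w c =
  all (λ i → all (λ j → not (invEdge w i j) ∨ not (lookup c i ≡ᵇ lookup c j)) (allFin n)) (allFin n)

-- Chromatic polynomial of G_w evaluated at t ∈ ℕ: the number of proper
-- colourings of G_w with t colours.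
chromInv : ∀ {n} → Perm n → ℕ → ℕ
chromInv {n} w t = length (filterᵇ (isProper w) (allVecs (allFin t) n))

-- Cell (a , b) (row a, column b) lies in the south-west diagram
-- O_w = {(i, w_j) : i < j, w_j > w_i}.
inO : ∀ {n} → Perm n → Fin n → Fin n → Bool
inO {n} w a b = any (λ j → (a <ᵇ j) ∧ ((w ⟨$⟩ʳ a) <ᵇ (w ⟨$⟩ʳ j)) ∧ (b ≡ᵇ (w ⟨$⟩ʳ j))) (allFin n)

-- A set of cells of [n]×[n] is encoded as a Boolean n×n array
-- (M[a][b] = true iff cell (a , b) is in the set).
Board : ℕ → Set
Board n = Vec (Vec Bool n) n

cell : ∀ {n} → Board n → Fin n → Fin n → Bool
cell M a b = lookup (lookup M a) b

boolToℕ : Bool → ℕ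
boolToℕ true = 1
boolToℕ false = 0

size : ∀ {n} → Board n → ℕ
size {n} M = sum (map (λ a → sum (map (λ b → boolToℕ (cell M a b)) (allFin n))) (allFin n))

isRookPlacement : ∀ {n} → Perm n → Board n → Bool
isRookPlacement {n} w M =
  all (λ a → all (λ b → not (cell M a b) ∨ inO w a b) (allFin n)) (allFin n) ∧
  all (λ a → all (λ b → all (λ a′ → all (λ b′ →
      not (cell M a b ∧ cell M a′ b′) ∨ (a ≡ᵇ a′ ∧ b ≡ᵇ b′) ∨
      (not (a ≡ᵇ a′) ∧ not (b ≡ᵇ b′)))
    (allFin n)) (allFin n)) (allFin n)) (allFin n)

rook : ∀ {n} → Perm n → ℕ → ℕ
rook {n} w k =
  length (filterᵇ (λ M → isRookPlacement w M ∧ ⌊ size M ≟ℕ k ⌋) (allVecs (allVecs (true ∷ false ∷ []) n) n))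

-- falling factorial t(t-1)...(t-i+1) (equals 1 for i = 0, and 0 if i > t)
fall : ℕ → ℕ → ℕ
fall t zero = 1
fall t (suc i) = fall t i * (t ∸ i)

sumTo : ℕ → (ℕ → ℕ) → ℕ
sumTo zero f = f 0
sumTo (suc n) f = sumTo n f + f (suc n)

-- Write x₁ ⋯ xₙ for the word w₁ ⋯ wₙ. A colouring of G_w is proper iff every colour class
-- increases from left to right, so it can be built by scanning the word from right to left
-- while each colour remembers its leftmost value: the next letter x either starts one of the
-- u unused colours or is put in front of a colour whose leftmost value is e ≥ x. A placement
-- of rooks on O_w is built by the same scan, remembering the values of the later positions
-- whose column is still free: row i either gets no rook, contributing the factor t − h of the
-- falling factorial after h rook-free rows, or takes the free column w_j of some later j with
-- x_j ≥ x_i. Weighting a state by K(E, u), with E the multiset of remembered values and u the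
-- number of colours still available (t − h on the rook side), both scans act on K by the same
-- transfer operator. So the two totals agree for every symmetric K, and for K = 1 the rook
-- side is Σ_k r_k(O_w) t(t − 1)⋯(t − n + k + 1).

module Submission where

open import Defs
open import Data.Bool using (Bool; true; false; _∧_; _∨_; not; T; if_then_else_)
open import Data.Bool.ListAction using (all; any)
open import Data.Bool.Properties using (T-∧; T-≡; ∧-identityʳ; ∧-zeroʳ) renaming (_≟_ to _≟ᵇ_)
open import Data.Empty using (⊥-elim)
open import Data.Fin using (Fin; zero; suc; toℕ; fromℕ<; _<?_) renaming (_≟_ to _≟ᶠ_)
open import Data.Fin.Permutation using (_⟨$⟩ʳ_; _⟨$⟩ˡ_; inverseˡ; inverseʳ)
open import Data.Fin.Properties using (toℕ-injective; toℕ-fromℕ<; toℕ<n)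
import Data.Fin.Properties as Fin
open import Data.List using (List; []; _∷_; map; concatMap; concat; allFin; filterᵇ; length; _++_; replicate)
import Data.List as List
open import Data.List.Membership.Propositional using (lose)
open import Data.List.Membership.Propositional.Properties using (∈-allFin)
open import Data.List.Properties using (map-++; map-cong; map-∘; length-replicate)
open import Data.List.Relation.Binary.Permutation.Propositional using (_↭_)
import Data.List.Relation.Binary.Permutation.Propositional as ↭
import Data.List.Relation.Unary.All as ListAll
open import Data.List.Relation.Unary.All.Properties using (all⁺; all⁻)
import Data.List.Relation.Unary.Any as ListAny
open import Data.List.Relation.Unary.Any.Properties using (any⁺; any⁻)
open import Data.Maybe using (Maybe; just; nothing; is-just; is-nothing; maybe′)
import Data.Maybe as Maybe
open import Data.Maybe.Properties using (just-injective) renaming (≡-dec to ≡-decᵐ)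
import Data.Maybe.Relation.Unary.All as MaybeAll
open import Data.Nat using (ℕ; zero; suc; _+_; _*_; _∸_; _≤_; _<_; s≤s; z≤n; z<s; _≤ᵇ_)
open import Data.Nat.ListAction using (sum)
open import Data.Nat.ListAction.Properties using (sum-++)
open import Data.Nat.Properties
  using (+-commutativeSemigroup; +-identityʳ; +-suc; *-comm; *-assoc; *-zeroʳ; *-identityˡ; *-identityʳ; *-distribˡ-+;
         ∸-+-assoc; +-comm; m+[n∸m]≡n; m+n∸m≡n; m∸n≤m; m∸[m∸n]≡n; suc-injective; 1+n≢0;
         ≤-refl; ≤-trans; ≤-pred; n≤1+n; m≤m+n; m≤n+m; m≤n⇒m≤1+n; 1+n≰n; m<m+n; <⇒≤; ≤∧≢⇒<; <-irrefl;
         ≮⇒≥; <⇒≱; ≤ᵇ⇒≤; ≤⇒≤ᵇ; module ≤-Reasoning)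
  renaming (_≟_ to _≟ⁿ_)
open import Algebra.Properties.CommutativeSemigroup +-commutativeSemigroup using (interchange; x∙yz≈y∙xz)
open import Data.Nat.Tactic.RingSolver using (solve-∀)
open import Data.Product using (_×_; _,_; ∃; ∃-syntax; proj₁; proj₂; map₂; uncurry)
open import Data.Unit using (⊤)
open import Data.Vec using (Vec; []; _∷_; lookup; tabulate)
open import Data.Vec.Properties using (lookup∘tabulate; tabulate∘lookup; tabulate-cong; ∷-injectiveˡ; ∷-injectiveʳ)
  renaming (≡-dec to ≡-decᵛ)
open import Data.Vec.Relation.Unary.All using (All; []; _∷_; universal)
open import Data.Vec.Relation.Unary.All.Properties using (lookup⁻)
open import Function using (_∘_; id; case_of_; _⇔_; mk⇔; Equivalence; Injection)
import Function.Properties.Equivalence as ⇔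
open import Function.Properties.Inverse using (↔⇒↣)
open import Relation.Binary.Definitions using (DecidableEquality)
open import Relation.Binary.PropositionalEquality
open import Relation.Nullary using (Dec; yes; no; ¬_)
open import Relation.Nullary.Decidable using (⌊_⌋; toWitness; fromWitness)

open Equivalence using (to; from)

private variable
  A B : Set

-- Finite sums

ΣL : List A → (A → ℕ) → ℕ
ΣL xs f = sum (map f xs)

ΣL-++ : ∀ (xs ys : List A) (f : A → ℕ) → ΣL (xs ++ ys) f ≡ ΣL xs f + ΣL ys f
ΣL-++ xs ys f = trans (cong sum (map-++ f xs ys)) (sum-++ (map f xs) (map f ys))

ΣL-cong : ∀ (xs : List A) {f g : A → ℕ} → (∀ x → f x ≡ g x) → ΣL xs f ≡ ΣL xs g
ΣL-cong xs f≗g = cong sum (map-cong f≗g xs)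

ΣL-map : ∀ (xs : List A) (g : A → B) (f : B → ℕ) → ΣL (map g xs) f ≡ ΣL xs (f ∘ g)
ΣL-map xs g f = cong sum (sym (map-∘ xs))

ΣL-concatMap : ∀ (xs : List A) (g : A → List B) (f : B → ℕ) → ΣL (concatMap g xs) f ≡ ΣL xs (λ x → ΣL (g x) f)
ΣL-concatMap [] g f = refl
ΣL-concatMap (x ∷ xs) g f =
  trans (ΣL-++ (g x) (concat (map g xs)) f) (cong (ΣL (g x) f +_) (ΣL-concatMap xs g f))

ΣL-+ : ∀ (xs : List A) (f g : A → ℕ) → ΣL xs (λ x → f x + g x) ≡ ΣL xs f + ΣL xs g
ΣL-+ [] f g = refl
ΣL-+ (x ∷ xs) f g =
  trans (cong (f x + g x +_) (ΣL-+ xs f g)) (interchange (f x) (g x) (ΣL xs f) (ΣL xs g))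

ΣL-*ˡ : ∀ (xs : List A) c (f : A → ℕ) → ΣL xs (λ x → c * f x) ≡ c * ΣL xs f
ΣL-*ˡ [] c f = sym (*-zeroʳ c)
ΣL-*ˡ (x ∷ xs) c f = trans (cong (c * f x +_) (ΣL-*ˡ xs c f)) (sym (*-distribˡ-+ c (f x) (ΣL xs f)))

ΣL-*ʳ : ∀ (xs : List A) c (f : A → ℕ) → ΣL xs (λ x → f x * c) ≡ ΣL xs f * c
ΣL-*ʳ xs c f = trans (ΣL-cong xs (λ x → *-comm (f x) c)) (trans (ΣL-*ˡ xs c f) (*-comm c _))

ΣL-zero : ∀ (xs : List A) {f : A → ℕ} → (∀ x → f x ≡ 0) → ΣL xs f ≡ 0
ΣL-zero [] f≗0 = refl
ΣL-zero (x ∷ xs) f≗0 = cong₂ _+_ (f≗0 x) (ΣL-zero xs f≗0)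

ΣL-swap : ∀ (xs : List A) (ys : List B) (f : A → B → ℕ) →
  ΣL xs (λ x → ΣL ys (f x)) ≡ ΣL ys (λ y → ΣL xs (λ x → f x y))
ΣL-swap [] ys f = sym (ΣL-zero ys {λ _ → 0} (λ _ → refl))
ΣL-swap (x ∷ xs) ys f =
  trans (cong (ΣL ys (f x) +_) (ΣL-swap xs ys f)) (sym (ΣL-+ ys (f x) (λ y → ΣL xs (λ x′ → f x′ y))))

ΣF : (n : ℕ) → (Fin n → ℕ) → ℕ
ΣF zero f = 0
ΣF (suc n) f = f zero + ΣF n (f ∘ suc)

ΣL-tabulate : ∀ n (g : Fin n → A) (f : A → ℕ) → ΣL (List.tabulate g) f ≡ ΣF n (f ∘ g)
ΣL-tabulate zero g f = refl
ΣL-tabulate (suc n) g f = cong (f (g zero) +_) (ΣL-tabulate n (g ∘ suc) f)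

ΣL-allFin : ∀ n (f : Fin n → ℕ) → ΣL (allFin n) f ≡ ΣF n f
ΣL-allFin n = ΣL-tabulate n id

ΣF-cong : ∀ n {f g : Fin n → ℕ} → (∀ i → f i ≡ g i) → ΣF n f ≡ ΣF n g
ΣF-cong zero f≗g = refl
ΣF-cong (suc n) f≗g = cong₂ _+_ (f≗g zero) (ΣF-cong n (f≗g ∘ suc))

ΣF-+ : ∀ n (f g : Fin n → ℕ) → ΣF n (λ i → f i + g i) ≡ ΣF n f + ΣF n g
ΣF-+ zero f g = refl
ΣF-+ (suc n) f g =
  trans (cong (f zero + g zero +_) (ΣF-+ n (f ∘ suc) (g ∘ suc))) (interchange (f zero) (g zero) _ _)

ΣF-*ˡ : ∀ n c (f : Fin n → ℕ) → ΣF n (λ i → c * f i) ≡ c * ΣF n f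
ΣF-*ˡ n c f = trans (sym (ΣL-allFin n _)) (trans (ΣL-*ˡ (allFin n) c f) (cong (c *_) (ΣL-allFin n f)))

ΣF-*ʳ : ∀ n c (f : Fin n → ℕ) → ΣF n (λ i → f i * c) ≡ ΣF n f * c
ΣF-*ʳ n c f = trans (sym (ΣL-allFin n _)) (trans (ΣL-*ʳ (allFin n) c f) (cong (_* c) (ΣL-allFin n f)))

ΣF-zero : ∀ n {f : Fin n → ℕ} → (∀ i → f i ≡ 0) → ΣF n f ≡ 0
ΣF-zero n f≗0 = trans (sym (ΣL-allFin n _)) (ΣL-zero (allFin n) f≗0)

length-filterᵇ : ∀ (p : A → Bool) xs → length (filterᵇ p xs) ≡ ΣL xs (boolToℕ ∘ p)
length-filterᵇ p [] = refl
length-filterᵇ p (x ∷ xs) with p x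
... | true = cong suc (length-filterᵇ p xs)
... | false = length-filterᵇ p xs

sumTo-cong : ∀ n {f g : ℕ → ℕ} → (∀ i → f i ≡ g i) → sumTo n f ≡ sumTo n g
sumTo-cong zero f≗g = f≗g 0
sumTo-cong (suc n) f≗g = cong₂ _+_ (sumTo-cong n f≗g) (f≗g (suc n))

sumTo-zero : ∀ n (f : ℕ → ℕ) → (∀ i → i ≤ n → f i ≡ 0) → sumTo n f ≡ 0
sumTo-zero zero f f≗0 = f≗0 0 z≤n
sumTo-zero (suc n) f f≗0 = cong₂ _+_ (sumTo-zero n f (λ i i≤n → f≗0 i (m≤n⇒m≤1+n i≤n))) (f≗0 (suc n) ≤-refl)

sumTo-single : ∀ n (f : ℕ → ℕ) k → k ≤ n → (∀ i → i ≤ n → i ≢ k → f i ≡ 0) → sumTo n f ≡ f k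
sumTo-single zero f .zero z≤n _ = refl
sumTo-single (suc n) f k k≤1+n f≗0 with k ≟ⁿ suc n
... | yes refl = cong (_+ f (suc n)) (sumTo-zero n f (λ i i≤n → f≗0 i (m≤n⇒m≤1+n i≤n) (λ { refl → 1+n≰n i≤n })))
... | no k≢1+n = trans
  (cong₂ _+_ (sumTo-single n f k (≤-pred (≤∧≢⇒< k≤1+n k≢1+n)) (λ i i≤n → f≗0 i (m≤n⇒m≤1+n i≤n)))
             (f≗0 (suc n) ≤-refl (k≢1+n ∘ sym)))
  (+-identityʳ (f k))

sumTo-ΣL : ∀ n (xs : List A) (F : ℕ → A → ℕ) → sumTo n (λ i → ΣL xs (F i)) ≡ ΣL xs (λ x → sumTo n (λ i → F i x))
sumTo-ΣL zero xs F = refl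
sumTo-ΣL (suc n) xs F = trans (cong (_+ ΣL xs (F (suc n))) (sumTo-ΣL n xs F)) (sym (ΣL-+ xs _ _))

boolToℕ-∧ : ∀ a b → boolToℕ (a ∧ b) ≡ boolToℕ a * boolToℕ b
boolToℕ-∧ true b = sym (+-identityʳ _)
boolToℕ-∧ false b = refl

T⇔T⇒≡ : ∀ {a b} → T a ⇔ T b → a ≡ b
T⇔T⇒≡ {false} {false} _ = refl
T⇔T⇒≡ {false} {true} a⇔b = ⊥-elim (from a⇔b _)
T⇔T⇒≡ {true} {false} a⇔b = ⊥-elim (to a⇔b _)
T⇔T⇒≡ {true} {true} _ = refl

boolToℕ*≢0⇒T : ∀ b {m} → boolToℕ b * m ≢ 0 → T b
boolToℕ*≢0⇒T true _ = _
boolToℕ*≢0⇒T false nonzero = ⊥-elim (nonzero refl)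

T-≤ᵇ : ∀ {m n} → T (m ≤ᵇ n) ⇔ m ≤ n
T-≤ᵇ {m} {n} = mk⇔ (≤ᵇ⇒≤ m n) ≤⇒≤ᵇ

T-⇒ : ∀ {p q} → T (not p ∨ q) ⇔ (T p → T q)
T-⇒ {false} = mk⇔ (λ _ ()) _
T-⇒ {true} = mk⇔ (λ q _ → q) (λ p⇒q → p⇒q _)

T-not∨not : ∀ {a b} → T (not a ∨ not b) ⇔ (T a → ¬ T b)
T-not∨not {false} = mk⇔ (λ _ ()) _
T-not∨not {true} {false} = mk⇔ (λ _ _ ()) _
T-not∨not {true} {true} = mk⇔ (λ ()) (λ a⇒¬b → a⇒¬b _ _)

T-⇔ : ∀ {a b} → T ((a ∧ b) ∨ (not a ∧ not b)) ⇔ (T a ⇔ T b)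
T-⇔ {false} {false} = mk⇔ (λ _ → mk⇔ (λ ()) (λ ())) _
T-⇔ {false} {true} = mk⇔ (λ ()) (λ a⇔b → from a⇔b _)
T-⇔ {true} {false} = mk⇔ (λ ()) (λ a⇔b → to a⇔b _)
T-⇔ {true} {true} = mk⇔ (λ _ → mk⇔ _ _) _

module _ {n} {p : Fin n → Bool} where

  T-all-allFin : T (all p (allFin n)) ⇔ (∀ i → T (p i))
  T-all-allFin = mk⇔ (λ h i → ListAll.lookup (all⁺ p (allFin n) h) (∈-allFin i))
                     (λ h → all⁻ p {allFin n} (ListAll.tabulate (λ {i} _ → h i)))

  T-any-allFin : T (any p (allFin n)) ⇔ ∃ (T ∘ p)
  T-any-allFin = mk⇔ (ListAny.satisfied ∘ any⁻ p (allFin n)) (λ (i , pi) → any⁺ p (lose (∈-allFin i) pi))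

-- Reindexing a sum along a bijection

𝟙 : Dec B → ℕ
𝟙 d = boolToℕ ⌊ d ⌋

𝟙-cong : {P Q : Set} → P ⇔ Q → (d : Dec P) (e : Dec Q) → 𝟙 d ≡ 𝟙 e
𝟙-cong P⇔Q (yes _) (yes _) = refl
𝟙-cong P⇔Q (yes p) (no ¬q) = ⊥-elim (¬q (to P⇔Q p))
𝟙-cong P⇔Q (no ¬p) (yes q) = ⊥-elim (¬p (from P⇔Q q))
𝟙-cong P⇔Q (no _) (no _) = refl

multiplicity : DecidableEquality A → List A → A → ℕ
multiplicity _≟_ xs x = ΣL xs (λ y → 𝟙 (y ≟ x))

-- Double counting the pairs (x , f x).
module _ (_≟A_ : DecidableEquality A) (_≟B_ : DecidableEquality B)
  (xs : List A) (ys : List B) (p : A → ℕ) (q : B → ℕ) (f : A → B) (g : B → A)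
  (once-xs : ∀ x → p x ≢ 0 → multiplicity _≟A_ xs x ≡ 1)
  (once-ys : ∀ y → q y ≢ 0 → multiplicity _≟B_ ys y ≡ 1)
  (gf : ∀ x → p x ≢ 0 → g (f x) ≡ x) (qf : ∀ x → p x ≢ 0 → q (f x) ≡ p x)
  (fg : ∀ y → q y ≢ 0 → f (g y) ≡ y) (pg : ∀ y → q y ≢ 0 → p (g y) ≡ q y) where

  private
    weight-on-graph : ∀ x y → y ≡ f x → x ≡ g y → p x ≡ q y
    weight-on-graph x y y≡fx x≡gy with p x ≟ⁿ 0 | q y ≟ⁿ 0
    ... | no px≢0 | _ = sym (trans (cong q y≡fx) (qf x px≢0))
    ... | yes px≡0 | yes qy≡0 = trans px≡0 (sym qy≡0)
    ... | yes _ | no qy≢0 = trans (cong p x≡gy) (pg y qy≢0)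

    p-off-graph : ∀ x → x ≢ g (f x) → p x ≡ 0
    p-off-graph x x≢gfx with p x ≟ⁿ 0
    ... | yes px≡0 = px≡0
    ... | no px≢0 = ⊥-elim (x≢gfx (sym (gf x px≢0)))

    q-off-graph : ∀ y → y ≢ f (g y) → q y ≡ 0
    q-off-graph y y≢fgy with q y ≟ⁿ 0
    ... | yes qy≡0 = qy≡0
    ... | no qy≢0 = ⊥-elim (y≢fgy (sym (fg y qy≢0)))

    graph-weight : ∀ x y → 𝟙 (y ≟B f x) * p x ≡ 𝟙 (x ≟A g y) * q y
    graph-weight x y with y ≟B f x | x ≟A g y
    ... | yes y≡fx | yes x≡gy = cong (_+ 0) (weight-on-graph x y y≡fx x≡gy)
    ... | yes refl | no x≢gy = trans (+-identityʳ _) (p-off-graph x x≢gy)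
    ... | no y≢fx | yes refl = sym (trans (+-identityʳ _) (q-off-graph y y≢fx))
    ... | no _ | no _ = refl

    spread-p : ∀ x → ΣL ys (λ y → 𝟙 (y ≟B f x) * p x) ≡ p x
    spread-p x with p x ≟ⁿ 0
    ... | yes px≡0 = trans (ΣL-zero ys (λ y → trans (cong (𝟙 (y ≟B f x) *_) px≡0) (*-zeroʳ (𝟙 (y ≟B f x))))) (sym px≡0)
    ... | no px≢0 = trans (ΣL-*ʳ ys (p x) (λ y → 𝟙 (y ≟B f x)))
      (trans (cong (_* p x) (once-ys (f x) (λ qfx≡0 → px≢0 (trans (sym (qf x px≢0)) qfx≡0)))) (+-identityʳ _))

    spread-q : ∀ y → ΣL xs (λ x → 𝟙 (x ≟A g y) * q y) ≡ q y
    spread-q y with q y ≟ⁿ 0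
    ... | yes qy≡0 = trans (ΣL-zero xs (λ x → trans (cong (𝟙 (x ≟A g y) *_) qy≡0) (*-zeroʳ (𝟙 (x ≟A g y))))) (sym qy≡0)
    ... | no qy≢0 = trans (ΣL-*ʳ xs (q y) (λ x → 𝟙 (x ≟A g y)))
      (trans (cong (_* q y) (once-xs (g y) (λ pgy≡0 → qy≢0 (trans (sym (pg y qy≢0)) pgy≡0)))) (+-identityʳ _))

  ΣL-bijection : ΣL xs p ≡ ΣL ys q
  ΣL-bijection = begin
    ΣL xs p                                             ≡⟨ ΣL-cong xs (sym ∘ spread-p) ⟩
    ΣL xs (λ x → ΣL ys (λ y → 𝟙 (y ≟B f x) * p x))     ≡⟨ ΣL-swap xs ys (λ x y → 𝟙 (y ≟B f x) * p x) ⟩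
    ΣL ys (λ y → ΣL xs (λ x → 𝟙 (y ≟B f x) * p x))     ≡⟨ ΣL-cong ys (λ y → ΣL-cong xs (λ x → graph-weight x y)) ⟩
    ΣL ys (λ y → ΣL xs (λ x → 𝟙 (x ≟A g y) * q y))     ≡⟨ ΣL-cong ys spread-q ⟩
    ΣL ys q                                             ∎
    where open ≡-Reasoning

multiplicity-allFin : ∀ n (i : Fin n) → multiplicity _≟ᶠ_ (allFin n) i ≡ 1
multiplicity-allFin n i = trans (ΣL-allFin n _) (ΣF-indicator n i)
  where
  ΣF-indicator : ∀ n (i : Fin n) → ΣF n (λ j → 𝟙 (j ≟ᶠ i)) ≡ 1
  ΣF-indicator (suc n) zero = cong suc (ΣF-zero n (λ _ → refl))
  ΣF-indicator (suc n) (suc i) =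
    trans (ΣF-cong n (λ j → 𝟙-cong (mk⇔ Fin.suc-injective (cong suc)) (suc j ≟ᶠ suc i) (j ≟ᶠ i))) (ΣF-indicator n i)

multiplicity-bools : ∀ b → multiplicity _≟ᵇ_ (true ∷ false ∷ []) b ≡ 1
multiplicity-bools true = refl
multiplicity-bools false = refl

𝟙-∷ : (_≟_ : DecidableEquality A) (x y : A) {k : ℕ} (u v : Vec A k) →
  𝟙 (≡-decᵛ _≟_ (x ∷ u) (y ∷ v)) ≡ 𝟙 (x ≟ y) * 𝟙 (≡-decᵛ _≟_ u v)
𝟙-∷ _≟_ x y u v with ≡-decᵛ _≟_ (x ∷ u) (y ∷ v) | x ≟ y | ≡-decᵛ _≟_ u v
... | yes _ | yes _ | yes _ = refl
... | yes x∷u≡y∷v | yes _ | no u≢v = ⊥-elim (u≢v (∷-injectiveʳ x∷u≡y∷v))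
... | yes x∷u≡y∷v | no x≢y | _ = ⊥-elim (x≢y (∷-injectiveˡ x∷u≡y∷v))
... | no x∷u≢y∷v | yes x≡y | yes u≡v = ⊥-elim (x∷u≢y∷v (cong₂ _∷_ x≡y u≡v))
... | no _ | yes _ | no _ = refl
... | no _ | no _ | _ = refl

ΣL-allVecs-suc : ∀ (xs : List A) k (h : Vec A (suc k) → ℕ) →
  ΣL (allVecs xs (suc k)) h ≡ ΣL xs (λ x → ΣL (allVecs xs k) (λ u → h (x ∷ u)))
ΣL-allVecs-suc xs k h = trans (ΣL-concatMap xs _ h) (ΣL-cong xs (λ x → ΣL-map (allVecs xs k) (x ∷_) h))

multiplicity-allVecs : (_≟_ : DecidableEquality A) (xs : List A) (P : A → Set) →
  (∀ x → P x → multiplicity _≟_ xs x ≡ 1) →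
  ∀ k (v : Vec A k) → All P v → multiplicity (≡-decᵛ _≟_) (allVecs xs k) v ≡ 1
multiplicity-allVecs _≟_ xs P once zero [] [] = refl
multiplicity-allVecs _≟_ xs P once (suc k) (y ∷ v) (py ∷ pv) = begin
  ΣL (allVecs xs (suc k)) (λ u → 𝟙 (≡-decᵛ _≟_ u (y ∷ v)))
    ≡⟨ ΣL-allVecs-suc xs k _ ⟩
  ΣL xs (λ x → ΣL (allVecs xs k) (λ u → 𝟙 (≡-decᵛ _≟_ (x ∷ u) (y ∷ v))))
    ≡⟨ ΣL-cong xs (λ x → ΣL-cong (allVecs xs k) (λ u → 𝟙-∷ _≟_ x y u v)) ⟩
  ΣL xs (λ x → ΣL (allVecs xs k) (λ u → 𝟙 (x ≟ y) * 𝟙 (≡-decᵛ _≟_ u v)))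
    ≡⟨ ΣL-cong xs (λ x → ΣL-*ˡ (allVecs xs k) (𝟙 (x ≟ y)) _) ⟩
  ΣL xs (λ x → 𝟙 (x ≟ y) * multiplicity (≡-decᵛ _≟_) (allVecs xs k) v)
    ≡⟨ ΣL-cong xs (λ x → cong (𝟙 (x ≟ y) *_) (multiplicity-allVecs _≟_ xs P once k v pv)) ⟩
  ΣL xs (λ x → 𝟙 (x ≟ y) * 1)
    ≡⟨ ΣL-cong xs (λ x → *-identityʳ (𝟙 (x ≟ y))) ⟩
  multiplicity _≟_ xs y
    ≡⟨ once y py ⟩
  1 ∎
  where open ≡-Reasoning

pointers : ℕ → List (Maybe ℕ)
pointers n = nothing ∷ map (just ∘ toℕ) (allFin n)

_≟ᵐ_ : DecidableEquality (Maybe ℕ)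
_≟ᵐ_ = ≡-decᵐ _≟ⁿ_

multiplicity-pointers : ∀ n m → MaybeAll.All (_< n) m → multiplicity _≟ᵐ_ (pointers n) m ≡ 1
multiplicity-pointers n nothing MaybeAll.nothing =
  cong suc (trans (ΣL-map (allFin n) _ _) (ΣL-zero (allFin n) (λ _ → refl)))
multiplicity-pointers n (just d) (MaybeAll.just d<n) = begin
  ΣL (map (just ∘ toℕ) (allFin n)) (λ m → 𝟙 (m ≟ᵐ just d))
    ≡⟨ ΣL-map (allFin n) _ _ ⟩
  ΣL (allFin n) (λ i → 𝟙 (just (toℕ i) ≟ᵐ just d))
    ≡⟨ ΣL-cong (allFin n) (λ i →
         𝟙-cong (mk⇔ (same-index i) (same-pointer i)) (just (toℕ i) ≟ᵐ just d) (i ≟ᶠ fromℕ< d<n)) ⟩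
  multiplicity _≟ᶠ_ (allFin n) (fromℕ< d<n)
    ≡⟨ multiplicity-allFin n (fromℕ< d<n) ⟩
  1 ∎
  where
  open ≡-Reasoning
  same-index : ∀ i → just (toℕ i) ≡ just d → i ≡ fromℕ< d<n
  same-index i eq = toℕ-injective (trans (just-injective eq) (sym (toℕ-fromℕ< d<n)))
  same-pointer : ∀ i → i ≡ fromℕ< d<n → just (toℕ i) ≡ just d
  same-pointer i refl = cong just (toℕ-fromℕ< d<n)

-- Slots and the transfer operator

Slots : Set
Slots = List (Maybe ℕ)

infixl 6 _[_]≔_
infixl 5 _‼_

_‼_ : Slots → ℕ → Maybe ℕ
[] ‼ d = nothing
(m ∷ S) ‼ zero = m
(m ∷ S) ‼ suc d = S ‼ d

_[_]≔_ : Slots → ℕ → Maybe ℕ → Slots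
[] [ d ]≔ v = []
(m ∷ S) [ zero ]≔ v = v ∷ S
(m ∷ S) [ suc d ]≔ v = m ∷ (S [ d ]≔ v)

contents : Slots → List ℕ
contents [] = []
contents (nothing ∷ S) = contents S
contents (just e ∷ S) = e ∷ contents S

vacancies : Slots → ℕ
vacancies [] = 0
vacancies (nothing ∷ S) = suc (vacancies S)
vacancies (just _ ∷ S) = vacancies S

length-[]≔ : ∀ S d v → length (S [ d ]≔ v) ≡ length S
length-[]≔ [] d v = refl
length-[]≔ (m ∷ S) zero v = refl
length-[]≔ (m ∷ S) (suc d) v = cong suc (length-[]≔ S d v)

‼-beyond : ∀ S d → length S ≤ d → S ‼ d ≡ nothing
‼-beyond [] d _ = refl
‼-beyond (m ∷ S) (suc d) (s≤s len≤d) = ‼-beyond S d len≤d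

‼-[]≔-same : ∀ S d v → d < length S → S [ d ]≔ v ‼ d ≡ v
‼-[]≔-same (m ∷ S) zero v _ = refl
‼-[]≔-same (m ∷ S) (suc d) v (s≤s d<len) = ‼-[]≔-same S d v d<len

‼-[]≔-other : ∀ S d d′ v → d ≢ d′ → S [ d ]≔ v ‼ d′ ≡ S ‼ d′
‼-[]≔-other [] d d′ v d≢d′ = refl
‼-[]≔-other (m ∷ S) zero zero v d≢d′ with () ← d≢d′ refl
‼-[]≔-other (m ∷ S) zero (suc d′) v d≢d′ = refl
‼-[]≔-other (m ∷ S) (suc d) zero v d≢d′ = refl
‼-[]≔-other (m ∷ S) (suc d) (suc d′) v d≢d′ = ‼-[]≔-other S d d′ v (d≢d′ ∘ cong suc)

‼-clear : ∀ S d → S [ d ]≔ nothing ‼ d ≡ nothing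
‼-clear [] d = refl
‼-clear (m ∷ S) zero = refl
‼-clear (m ∷ S) (suc d) = ‼-clear S d

‼-replicate : ∀ t d → replicate t nothing ‼ d ≡ nothing
‼-replicate zero d = refl
‼-replicate (suc t) zero = refl
‼-replicate (suc t) (suc d) = ‼-replicate t d

clear-vacant : ∀ S d → S ‼ d ≡ nothing → S [ d ]≔ nothing ≡ S
clear-vacant [] d _ = refl
clear-vacant (m ∷ S) zero m≡nothing = cong (_∷ S) (sym m≡nothing)
clear-vacant (m ∷ S) (suc d) vacant = cong (m ∷_) (clear-vacant S d vacant)

contents-fill : ∀ S d x → d < length S → contents (S [ d ]≔ just x) ↭ x ∷ contents (S [ d ]≔ nothing)
contents-fill (m ∷ S) zero x _ = ↭.refl
contents-fill (nothing ∷ S) (suc d) x (s≤s d<len) = contents-fill S d x d<len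
contents-fill (just a ∷ S) (suc d) x (s≤s d<len) = ↭.trans (↭.prep a (contents-fill S d x d<len)) (↭.swap a x ↭.refl)

vacancies-fill-vacant : ∀ S d x → d < length S → S ‼ d ≡ nothing →
  suc (vacancies (S [ d ]≔ just x)) ≡ vacancies S
vacancies-fill-vacant (nothing ∷ S) zero x _ _ = refl
vacancies-fill-vacant (nothing ∷ S) (suc d) x (s≤s d<len) vacant = cong suc (vacancies-fill-vacant S d x d<len vacant)
vacancies-fill-vacant (just a ∷ S) (suc d) x (s≤s d<len) vacant = vacancies-fill-vacant S d x d<len vacant

vacancies-fill-occupied : ∀ S d x {e} → S ‼ d ≡ just e → vacancies (S [ d ]≔ just x) ≡ vacancies S
vacancies-fill-occupied (just a ∷ S) zero x _ = refl
vacancies-fill-occupied (nothing ∷ S) (suc d) x occupied = cong suc (vacancies-fill-occupied S d x occupied)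
vacancies-fill-occupied (just a ∷ S) (suc d) x occupied = vacancies-fill-occupied S d x occupied

ΣF-vacant≡vacancies : ∀ S → ΣF (length S) (λ i → boolToℕ (is-nothing (S ‼ toℕ i))) ≡ vacancies S
ΣF-vacant≡vacancies [] = refl
ΣF-vacant≡vacancies (nothing ∷ S) = cong suc (ΣF-vacant≡vacancies S)
ΣF-vacant≡vacancies (just _ ∷ S) = ΣF-vacant≡vacancies S

ΣF-vanishing-tail : ∀ N k (h : ℕ → ℕ) → k ≤ N → (∀ d → k ≤ d → h d ≡ 0) → ΣF N (h ∘ toℕ) ≡ ΣF k (h ∘ toℕ)
ΣF-vanishing-tail N zero h _ tail≡0 = ΣF-zero N (λ i → tail≡0 (toℕ i) z≤n)
ΣF-vanishing-tail (suc N) (suc k) h (s≤s k≤N) tail≡0 =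
  cong (h 0 +_) (ΣF-vanishing-tail N k (h ∘ suc) k≤N (λ d k≤d → tail≡0 (suc d) (s≤s k≤d)))

picks : List ℕ → List (ℕ × List ℕ)
picks [] = []
picks (a ∷ E) = (a , E) ∷ map (map₂ (a ∷_)) (picks E)

ΣP : List ℕ → (ℕ → List ℕ → ℕ) → ℕ
ΣP E G = ΣL (picks E) (uncurry G)

ΣP-∷ : ∀ a E G → ΣP (a ∷ E) G ≡ G a E + ΣP E (λ e R → G e (a ∷ R))
ΣP-∷ a E G = cong (G a E +_) (ΣL-map (picks E) _ _)

removal : Slots → (ℕ → List ℕ → ℕ) → ℕ → ℕ
removal S G d = maybe′ (λ e → G e (contents (S [ d ]≔ nothing))) 0 (S ‼ d)

ΣF-removal≡ΣP : ∀ S G → ΣF (length S) (removal S G ∘ toℕ) ≡ ΣP (contents S) G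
ΣF-removal≡ΣP [] G = refl
ΣF-removal≡ΣP (nothing ∷ S) G = ΣF-removal≡ΣP S G
ΣF-removal≡ΣP (just a ∷ S) G =
  trans (cong (G a (contents S) +_) (ΣF-removal≡ΣP S (λ e R → G e (a ∷ R)))) (sym (ΣP-∷ a (contents S) G))

ΣP-↭ : ∀ {E E′} → E ↭ E′ → ∀ G H → (∀ e {R R′} → R ↭ R′ → G e R ≡ H e R′) → ΣP E G ≡ ΣP E′ H
ΣP-↭ {E} ↭.refl G H G≈H = ΣL-cong (picks E) (λ (e , R) → G≈H e ↭.refl)
ΣP-↭ {a ∷ E} {a ∷ E′} (↭.prep a E↭E′) G H G≈H = begin
  ΣP (a ∷ E) G                              ≡⟨ ΣP-∷ a E G ⟩
  G a E + ΣP E (λ e R → G e (a ∷ R))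
    ≡⟨ cong₂ _+_ (G≈H a E↭E′) (ΣP-↭ E↭E′ _ _ (λ e R↭R′ → G≈H e (↭.prep a R↭R′))) ⟩
  H a E′ + ΣP E′ (λ e R → H e (a ∷ R))      ≡⟨ sym (ΣP-∷ a E′ H) ⟩
  ΣP (a ∷ E′) H                             ∎
  where open ≡-Reasoning
ΣP-↭ {a ∷ b ∷ E} {b ∷ a ∷ E′} (↭.swap a b E↭E′) G H G≈H = begin
  ΣP (a ∷ b ∷ E) G
    ≡⟨ trans (ΣP-∷ a (b ∷ E) G) (cong (G a (b ∷ E) +_) (ΣP-∷ b E _)) ⟩
  G a (b ∷ E) + (G b (a ∷ E) + ΣP E (λ e R → G e (a ∷ b ∷ R)))
    ≡⟨ cong₂ (λ u v → u + (v + _)) (G≈H a (↭.prep b E↭E′)) (G≈H b (↭.prep a E↭E′)) ⟩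
  H a (b ∷ E′) + (H b (a ∷ E′) + ΣP E (λ e R → G e (a ∷ b ∷ R)))
    ≡⟨ cong (λ z → H a (b ∷ E′) + (H b (a ∷ E′) + z))
            (ΣP-↭ E↭E′ _ _ (λ e R↭R′ → G≈H e (↭.swap a b R↭R′))) ⟩
  H a (b ∷ E′) + (H b (a ∷ E′) + ΣP E′ (λ e R → H e (b ∷ a ∷ R)))
    ≡⟨ x∙yz≈y∙xz (H a (b ∷ E′)) (H b (a ∷ E′)) _ ⟩
  H b (a ∷ E′) + (H a (b ∷ E′) + ΣP E′ (λ e R → H e (b ∷ a ∷ R)))
    ≡⟨ sym (trans (ΣP-∷ b (a ∷ E′) H) (cong (H b (a ∷ E′) +_) (ΣP-∷ a E′ _))) ⟩
  ΣP (b ∷ a ∷ E′) H ∎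
  where open ≡-Reasoning
ΣP-↭ (↭.trans E↭E″ E″↭E′) G H G≈H = trans (ΣP-↭ E↭E″ G G G≈G) (ΣP-↭ E″↭E′ G H G≈H)
  where
  G≈G : ∀ e {R R′} → R ↭ R′ → G e R ≡ G e R′
  G≈G e {R} {R′} R↭R′ = trans (G≈H e R↭R′) (sym (G≈H e {R′} ↭.refl))

PermInvariant : (List ℕ → ℕ → ℕ) → Set
PermInvariant K = ∀ {E E′} u → E ↭ E′ → K E u ≡ K E′ u

-- x either occupies one of the u vacant slots, or replaces an occupant e ≥ x.
transfer : ℕ → (List ℕ → ℕ → ℕ) → List ℕ → ℕ → ℕ
transfer x K E u = u * K (x ∷ E) (u ∸ 1) + ΣP E (λ e R → boolToℕ (x ≤ᵇ e) * K (x ∷ R) u)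

transfer-invariant : ∀ x K → PermInvariant K → PermInvariant (transfer x K)
transfer-invariant x K K-inv u E↭E′ = cong₂ _+_ (cong (u *_) (K-inv (u ∸ 1) (↭.prep x E↭E′)))
  (ΣP-↭ E↭E′ _ _ (λ e R↭R′ → cong (boolToℕ (x ≤ᵇ e) *_) (K-inv u (↭.prep x R↭R′))))

-- Colourings with increasing colour classes

admits : Maybe ℕ → ℕ → Bool
admits nothing x = true
admits (just e) x = x ≤ᵇ e

-- Slot y holds the value at the leftmost position coloured y.
colourTops : ∀ {t k} → Vec ℕ k → Vec (Fin t) k → Slots
colourTops {t} [] [] = replicate t nothing
colourTops (x ∷ xs) (y ∷ c) = colourTops xs c [ toℕ y ]≔ just x

monotoneClassesᵇ : ∀ {t k} → Vec ℕ k → Vec (Fin t) k → Bool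
monotoneClassesᵇ [] [] = true
monotoneClassesᵇ (x ∷ xs) (y ∷ c) = monotoneClassesᵇ xs c ∧ admits (colourTops xs c ‼ toℕ y) x

colourSum : (t : ℕ) → ∀ {k} → Vec ℕ k → (List ℕ → ℕ → ℕ) → ℕ
colourSum t {k} xs K = ΣL (allVecs (allFin t) k) λ c →
  boolToℕ (monotoneClassesᵇ xs c) * K (contents (colourTops xs c)) (vacancies (colourTops xs c))

length-colourTops : ∀ {t k} (xs : Vec ℕ k) (c : Vec (Fin t) k) → length (colourTops xs c) ≡ t
length-colourTops {t} [] [] = length-replicate t
length-colourTops (x ∷ xs) (y ∷ c) = trans (length-[]≔ (colourTops xs c) (toℕ y) (just x)) (length-colourTops xs c)

colourSum-[] : ∀ t K → colourSum t [] K ≡ K [] t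
colourSum-[] t K = trans (+-identityʳ _) (trans (+-identityʳ _) (cong₂ K (contents-empty t) (vacancies-empty t)))
  where
  contents-empty : ∀ t → contents (replicate t nothing) ≡ []
  contents-empty zero = refl
  contents-empty (suc t) = contents-empty t
  vacancies-empty : ∀ t → vacancies (replicate t nothing) ≡ t
  vacancies-empty zero = refl
  vacancies-empty (suc t) = cong suc (vacancies-empty t)

colour-choice : ∀ S x K → PermInvariant K → ∀ d → d < length S →
  boolToℕ (admits (S ‼ d) x) * K (contents (S [ d ]≔ just x)) (vacancies (S [ d ]≔ just x))
  ≡ boolToℕ (is-nothing (S ‼ d)) * K (x ∷ contents S) (vacancies S ∸ 1)
    + removal S (λ e R → boolToℕ (x ≤ᵇ e) * K (x ∷ R) (vacancies S)) d
colour-choice S x K K-inv d d<len with S ‼ d in S[d]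
... | nothing = begin
  1 * K (contents (S [ d ]≔ just x)) (vacancies (S [ d ]≔ just x))
    ≡⟨ *-identityˡ _ ⟩
  K (contents (S [ d ]≔ just x)) (vacancies (S [ d ]≔ just x))
    ≡⟨ K-inv _ (contents-fill S d x d<len) ⟩
  K (x ∷ contents (S [ d ]≔ nothing)) (vacancies (S [ d ]≔ just x))
    ≡⟨ cong₂ (λ S′ v → K (x ∷ contents S′) v) (clear-vacant S d S[d]) (cong (_∸ 1) (vacancies-fill-vacant S d x d<len S[d])) ⟩
  K (x ∷ contents S) (vacancies S ∸ 1)
    ≡⟨ sym (trans (+-identityʳ _) (*-identityˡ _)) ⟩
  1 * K (x ∷ contents S) (vacancies S ∸ 1) + 0 ∎
  where open ≡-Reasoning
... | just e = cong (boolToℕ (x ≤ᵇ e) *_)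
  (trans (K-inv _ (contents-fill S d x d<len)) (cong (K (x ∷ contents (S [ d ]≔ nothing))) (vacancies-fill-occupied S d x S[d])))

Σ-colour-choice : ∀ S x K → PermInvariant K →
  ΣF (length S) (λ i → boolToℕ (admits (S ‼ toℕ i) x) * K (contents (S [ toℕ i ]≔ just x)) (vacancies (S [ toℕ i ]≔ just x)))
  ≡ transfer x K (contents S) (vacancies S)
Σ-colour-choice S x K K-inv = begin
  _ ≡⟨ ΣF-cong (length S) (λ i → colour-choice S x K K-inv (toℕ i) (toℕ<n i)) ⟩
  ΣF (length S) (λ i → boolToℕ (is-nothing (S ‼ toℕ i)) * K (x ∷ contents S) (vacancies S ∸ 1) + removal S G (toℕ i))
    ≡⟨ ΣF-+ (length S) _ _ ⟩
  ΣF (length S) (λ i → boolToℕ (is-nothing (S ‼ toℕ i)) * K (x ∷ contents S) (vacancies S ∸ 1))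
    + ΣF (length S) (removal S G ∘ toℕ)
    ≡⟨ cong₂ _+_ (trans (ΣF-*ʳ (length S) _ _) (cong (_* K (x ∷ contents S) (vacancies S ∸ 1)) (ΣF-vacant≡vacancies S)))
                 (ΣF-removal≡ΣP S G) ⟩
  vacancies S * K (x ∷ contents S) (vacancies S ∸ 1) + ΣP (contents S) G ∎
  where
  open ≡-Reasoning
  G : ℕ → List ℕ → ℕ
  G e R = boolToℕ (x ≤ᵇ e) * K (x ∷ R) (vacancies S)

colourSum-∷ : ∀ t {k} x (xs : Vec ℕ k) K → PermInvariant K → colourSum t (x ∷ xs) K ≡ colourSum t xs (transfer x K)
colourSum-∷ t {k} x xs K K-inv = begin
  colourSum t (x ∷ xs) K
    ≡⟨ ΣL-allVecs-suc (allFin t) k _ ⟩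
  ΣL (allFin t) (λ y → ΣL (allVecs (allFin t) k) (F y))
    ≡⟨ ΣL-swap (allFin t) (allVecs (allFin t) k) F ⟩
  ΣL (allVecs (allFin t) k) (λ c → ΣL (allFin t) (λ y → F y c))
    ≡⟨ ΣL-cong (allVecs (allFin t) k) colour-last ⟩
  colourSum t xs (transfer x K) ∎
  where
  open ≡-Reasoning
  F : Fin t → Vec (Fin t) k → ℕ
  F y c = boolToℕ (monotoneClassesᵇ (x ∷ xs) (y ∷ c))
    * K (contents (colourTops (x ∷ xs) (y ∷ c))) (vacancies (colourTops (x ∷ xs) (y ∷ c)))
  colour-last : ∀ c → ΣL (allFin t) (λ y → F y c)
    ≡ boolToℕ (monotoneClassesᵇ xs c) * transfer x K (contents (colourTops xs c)) (vacancies (colourTops xs c))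
  colour-last c = begin
    ΣL (allFin t) (λ y → F y c)
      ≡⟨ ΣL-cong (allFin t) (λ y →
           trans (cong (_* Kfill (toℕ y)) (boolToℕ-∧ P (admits (S ‼ toℕ y) x))) (*-assoc (boolToℕ P) _ _)) ⟩
    ΣL (allFin t) (λ y → boolToℕ P * h (toℕ y))
      ≡⟨ trans (ΣL-*ˡ (allFin t) (boolToℕ P) (h ∘ toℕ)) (cong (boolToℕ P *_) (ΣL-allFin t _)) ⟩
    boolToℕ P * ΣF t (h ∘ toℕ)
      ≡⟨ cong (λ n → boolToℕ P * ΣF n (h ∘ toℕ)) (sym (length-colourTops xs c)) ⟩
    boolToℕ P * ΣF (length S) (h ∘ toℕ)
      ≡⟨ cong (boolToℕ P *_) (Σ-colour-choice S x K K-inv) ⟩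
    boolToℕ P * transfer x K (contents S) (vacancies S) ∎
    where
    S = colourTops xs c
    P = monotoneClassesᵇ xs c
    Kfill : ℕ → ℕ
    Kfill d = K (contents (S [ d ]≔ just x)) (vacancies (S [ d ]≔ just x))
    h : ℕ → ℕ
    h d = boolToℕ (admits (S ‼ d) x) * Kfill d

MonotoneClasses : ∀ {t k} → Vec ℕ k → Vec (Fin t) k → Set
MonotoneClasses xs c = ∀ i j → toℕ i < toℕ j → lookup c i ≡ lookup c j → lookup xs i ≤ lookup xs j

‼-colourTops-[]≔ : ∀ {t k} (xs : Vec ℕ k) (c : Vec (Fin t) k) (y : Fin t) x →
  colourTops xs c [ toℕ y ]≔ just x ‼ toℕ y ≡ just x
‼-colourTops-[]≔ xs c y x =
  ‼-[]≔-same (colourTops xs c) (toℕ y) (just x) (subst (toℕ y <_) (sym (length-colourTops xs c)) (toℕ<n y))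

admits⇒lower-bound : ∀ {t k} (xs : Vec ℕ k) (c : Vec (Fin t) k) (y : Fin t) x →
  T (monotoneClassesᵇ xs c) → T (admits (colourTops xs c ‼ toℕ y) x) → ∀ j → lookup c j ≡ y → x ≤ lookup xs j
admits⇒lower-bound (x′ ∷ xs) (y′ ∷ c) y x mono adm j cj≡y with to T-∧ mono | y′ ≟ᶠ y
... | mono′ , adm′ | yes refl = bound j cj≡y
  where
  x≤x′ : x ≤ x′
  x≤x′ = to T-≤ᵇ (subst (λ m → T (admits m x)) (‼-colourTops-[]≔ xs c y x′) adm)
  bound : ∀ j → lookup (y ∷ c) j ≡ y → x ≤ lookup (x′ ∷ xs) j
  bound zero _ = x≤x′
  bound (suc j) cj≡y = ≤-trans x≤x′ (admits⇒lower-bound xs c y x′ mono′ adm′ j cj≡y)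
... | mono′ , _ | no y′≢y = bound j cj≡y
  where
  bound : ∀ j → lookup (y′ ∷ c) j ≡ y → x ≤ lookup (x′ ∷ xs) j
  bound zero y′≡y = ⊥-elim (y′≢y y′≡y)
  bound (suc j) cj≡y = admits⇒lower-bound xs c y x mono′
    (subst (λ m → T (admits m x)) (‼-[]≔-other (colourTops xs c) (toℕ y′) (toℕ y) (just x′) (y′≢y ∘ toℕ-injective)) adm)
    j cj≡y

lower-bound⇒admits : ∀ {t k} (xs : Vec ℕ k) (c : Vec (Fin t) k) (y : Fin t) x →
  T (monotoneClassesᵇ xs c) → (∀ j → lookup c j ≡ y → x ≤ lookup xs j) → T (admits (colourTops xs c ‼ toℕ y) x)
lower-bound⇒admits {t} [] [] y x _ _ = subst (λ m → T (admits m x)) (sym (‼-replicate t (toℕ y))) _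
lower-bound⇒admits (x′ ∷ xs) (y′ ∷ c) y x mono bound with to T-∧ mono | y′ ≟ᶠ y
... | _ | yes refl = subst (λ m → T (admits m x)) (sym (‼-colourTops-[]≔ xs c y x′)) (from T-≤ᵇ (bound zero refl))
... | mono′ , _ | no y′≢y =
  subst (λ m → T (admits m x)) (sym (‼-[]≔-other (colourTops xs c) (toℕ y′) (toℕ y) (just x′) (y′≢y ∘ toℕ-injective)))
    (lower-bound⇒admits xs c y x mono′ (bound ∘ suc))

monotoneClassesᵇ⇔ : ∀ {t k} (xs : Vec ℕ k) (c : Vec (Fin t) k) → T (monotoneClassesᵇ xs c) ⇔ MonotoneClasses xs c
monotoneClassesᵇ⇔ xs c = mk⇔ (sound xs c) (complete xs c)
  where
  sound : ∀ {t k} (xs : Vec ℕ k) (c : Vec (Fin t) k) → T (monotoneClassesᵇ xs c) → MonotoneClasses xs c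
  sound (x ∷ xs) (y ∷ c) mono zero (suc j) _ y≡cj with to T-∧ mono
  ... | mono′ , adm = admits⇒lower-bound xs c y x mono′ adm j (sym y≡cj)
  sound (x ∷ xs) (y ∷ c) mono (suc i) (suc j) (s≤s i<j) ci≡cj = sound xs c (to T-∧ mono .proj₁) i j i<j ci≡cj
  complete : ∀ {t k} (xs : Vec ℕ k) (c : Vec (Fin t) k) → MonotoneClasses xs c → T (monotoneClassesᵇ xs c)
  complete [] [] _ = _
  complete (x ∷ xs) (y ∷ c) mono =
    from T-∧ (mono′ , lower-bound⇒admits xs c y x mono′ (λ j y≡cj → mono zero (suc j) (s≤s z≤n) (sym y≡cj)))
    where mono′ = complete xs c (λ i j i<j → mono (suc i) (suc j) (s≤s i<j))

-- Pointer vectors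

accepts : Maybe ℕ → ℕ → Bool
accepts nothing x = false
accepts (just e) x = x ≤ᵇ e

pointsAbove : ℕ → Maybe ℕ → Slots → Bool
pointsAbove x nothing S = true
pointsAbove x (just d) S = accepts (S ‼ d) x

release : Maybe ℕ → Slots → Slots
release nothing S = S
release (just d) S = S [ d ]≔ nothing

-- Slot d after position a stands for position a + 1 + d; it holds that position's
-- value until some earlier position points at it.
openTargets : ∀ {k} → Vec ℕ k → Vec (Maybe ℕ) k → Slots
openTargets [] [] = []
openTargets (x ∷ xs) (s ∷ σ) = just x ∷ release s (openTargets xs σ)

validᵇ : ∀ {k} → Vec ℕ k → Vec (Maybe ℕ) k → Bool
validᵇ [] [] = true
validᵇ (x ∷ xs) (s ∷ σ) = validᵇ xs σ ∧ pointsAbove x s (openTargets xs σ)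

unmatched : ∀ {k} → Vec (Maybe ℕ) k → ℕ
unmatched [] = 0
unmatched (nothing ∷ σ) = suc (unmatched σ)
unmatched (just _ ∷ σ) = unmatched σ

-- Pointers are drawn from the fixed list pointers N, with N ≥ k, so that every step of the
-- recursion sums over the same list.
pointerSum : (N t : ℕ) → ∀ {k} → Vec ℕ k → (List ℕ → ℕ → ℕ) → ℕ
pointerSum N t {k} xs K = ΣL (allVecs (pointers N) k) λ σ →
  boolToℕ (validᵇ xs σ) * (fall t (unmatched σ) * K (contents (openTargets xs σ)) (t ∸ unmatched σ))

length-openTargets : ∀ {k} (xs : Vec ℕ k) σ → length (openTargets xs σ) ≡ k
length-openTargets [] [] = refl
length-openTargets (x ∷ xs) (nothing ∷ σ) = cong suc (length-openTargets xs σ)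
length-openTargets (x ∷ xs) (just d ∷ σ) = cong suc (trans (length-[]≔ (openTargets xs σ) d nothing) (length-openTargets xs σ))

pointerSum-[] : ∀ N t K → pointerSum N t [] K ≡ K [] t
pointerSum-[] N t K = trans (+-identityʳ _) (trans (+-identityʳ _) (+-identityʳ _))

module _ (N t : ℕ) {k} (x : ℕ) (xs : Vec ℕ k) (K : List ℕ → ℕ → ℕ) (σ : Vec (Maybe ℕ) k) where

  private
    S = openTargets xs σ
    V = boolToℕ (validᵇ xs σ)
    u = t ∸ unmatched σ
    Fh = fall t (unmatched σ)
    G : ℕ → List ℕ → ℕ
    G e R = boolToℕ (x ≤ᵇ e) * K (x ∷ R) u
    Kclear : ℕ → ℕ
    Kclear d = K (x ∷ contents (S [ d ]≔ nothing)) u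

  pointer-weight : Maybe ℕ → ℕ
  pointer-weight s = boolToℕ (validᵇ (x ∷ xs) (s ∷ σ))
    * (fall t (unmatched (s ∷ σ)) * K (contents (openTargets (x ∷ xs) (s ∷ σ))) (t ∸ unmatched (s ∷ σ)))

  -- A rook-free row turns fall t h into fall t h * (t ∸ h), the factor u of the transfer operator.
  pointer-weight-nothing : pointer-weight nothing ≡ V * (Fh * (u * K (x ∷ contents S) (u ∸ 1)))
  pointer-weight-nothing = cong₂ _*_ (cong boolToℕ (∧-identityʳ (validᵇ xs σ)))
    (trans (cong (λ v → Fh * u * K (x ∷ contents S) v) t∸1+h≡u∸1) (*-assoc Fh u _))
    where
    t∸1+h≡u∸1 : t ∸ suc (unmatched σ) ≡ u ∸ 1
    t∸1+h≡u∸1 = sym (trans (∸-+-assoc t (unmatched σ) 1) (cong (t ∸_) (+-comm (unmatched σ) 1)))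

  pointer-weight-just : ∀ d → pointer-weight (just d) ≡ V * (Fh * removal S G d)
  pointer-weight-just d with S ‼ d
  ... | nothing = trans (cong (λ b → boolToℕ b * (Fh * Kclear d)) (∧-zeroʳ (validᵇ xs σ)))
                        (sym (trans (cong (V *_) (*-zeroʳ Fh)) (*-zeroʳ V)))
  ... | just e = trans (cong (_* (Fh * Kclear d)) (boolToℕ-∧ (validᵇ xs σ) (x ≤ᵇ e)))
                       (rearrange V (boolToℕ (x ≤ᵇ e)) Fh (Kclear d))
    where
    rearrange : ∀ b c f m → b * c * (f * m) ≡ b * (f * (c * m))
    rearrange = solve-∀

  Σ-pointer-choice : k ≤ N →
    ΣL (pointers N) pointer-weight ≡ V * (Fh * transfer x K (contents S) u)
  Σ-pointer-choice k≤N = begin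
    pointer-weight nothing + ΣL (map (just ∘ toℕ) (allFin N)) pointer-weight
      ≡⟨ cong₂ _+_ pointer-weight-nothing
           (trans (ΣL-map (allFin N) _ _) (trans (ΣL-allFin N _) (ΣF-cong N (pointer-weight-just ∘ toℕ)))) ⟩
    V * (Fh * (u * K₁)) + ΣF N (λ i → V * (Fh * removal S G (toℕ i)))
      ≡⟨ cong (V * (Fh * (u * K₁)) +_) (trans (ΣF-*ˡ N V _) (cong (V *_) (ΣF-*ˡ N Fh _))) ⟩
    V * (Fh * (u * K₁)) + V * (Fh * ΣF N (removal S G ∘ toℕ))
      ≡⟨ cong (λ z → V * (Fh * (u * K₁)) + V * (Fh * z)) removals ⟩
    V * (Fh * (u * K₁)) + V * (Fh * ΣP (contents S) G)
      ≡⟨ factor V Fh (u * K₁) _ ⟩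
    V * (Fh * transfer x K (contents S) u) ∎
    where
    open ≡-Reasoning
    K₁ = K (x ∷ contents S) (u ∸ 1)
    factor : ∀ b f m n → b * (f * m) + b * (f * n) ≡ b * (f * (m + n))
    factor = solve-∀
    removals : ΣF N (removal S G ∘ toℕ) ≡ ΣP (contents S) G
    removals = begin
      ΣF N (removal S G ∘ toℕ)
        ≡⟨ ΣF-vanishing-tail N k (removal S G) k≤N (λ d k≤d → cong (maybe′ _ 0)
             (‼-beyond S d (subst (_≤ d) (sym (length-openTargets xs σ)) k≤d))) ⟩
      ΣF k (removal S G ∘ toℕ)
        ≡⟨ cong (λ n → ΣF n (removal S G ∘ toℕ)) (sym (length-openTargets xs σ)) ⟩
      ΣF (length S) (removal S G ∘ toℕ)
        ≡⟨ ΣF-removal≡ΣP S G ⟩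
      ΣP (contents S) G ∎

pointerSum-∷ : ∀ N t {k} x (xs : Vec ℕ k) K → suc k ≤ N →
  pointerSum N t (x ∷ xs) K ≡ pointerSum N t xs (transfer x K)
pointerSum-∷ N t {k} x xs K 1+k≤N = begin
  pointerSum N t (x ∷ xs) K
    ≡⟨ ΣL-allVecs-suc (pointers N) k _ ⟩
  ΣL (pointers N) (λ s → ΣL (allVecs (pointers N) k) (λ σ → pointer-weight N t x xs K σ s))
    ≡⟨ ΣL-swap (pointers N) (allVecs (pointers N) k) (λ s σ → pointer-weight N t x xs K σ s) ⟩
  ΣL (allVecs (pointers N) k) (λ σ → ΣL (pointers N) (pointer-weight N t x xs K σ))
    ≡⟨ ΣL-cong (allVecs (pointers N) k) (λ σ → Σ-pointer-choice N t x xs K σ (≤-trans (n≤1+n k) 1+k≤N)) ⟩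
  pointerSum N t xs (transfer x K) ∎
  where open ≡-Reasoning

colourSum≡pointerSum : ∀ N t {k} (xs : Vec ℕ k) → k ≤ N → ∀ K → PermInvariant K →
  colourSum t xs K ≡ pointerSum N t xs K
colourSum≡pointerSum N t [] _ K _ = trans (colourSum-[] t K) (sym (pointerSum-[] N t K))
colourSum≡pointerSum N t {suc k} (x ∷ xs) 1+k≤N K K-inv = begin
  colourSum t (x ∷ xs) K
    ≡⟨ colourSum-∷ t x xs K K-inv ⟩
  colourSum t xs (transfer x K)
    ≡⟨ colourSum≡pointerSum N t xs (≤-trans (n≤1+n k) 1+k≤N) (transfer x K) (transfer-invariant x K K-inv) ⟩
  pointerSum N t xs (transfer x K)
    ≡⟨ sym (pointerSum-∷ N t x xs K 1+k≤N) ⟩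
  pointerSum N t (x ∷ xs) K ∎
  where open ≡-Reasoning

lookupOr : ∀ {k} → A → Vec A k → ℕ → A
lookupOr a [] i = a
lookupOr a (x ∷ v) zero = x
lookupOr a (x ∷ v) (suc i) = lookupOr a v i

target : ℕ → ℕ → ℕ
target i d = i + suc d

target≢0 : ∀ i d → target i d ≢ 0
target≢0 i d i+1+d≡0 = 1+n≢0 (trans (sym (+-suc i d)) i+1+d≡0)

record ValidPointers {k} (xs : Vec ℕ k) (σ : Vec (Maybe ℕ) k) : Set where
  field
    target-in-range : ∀ i d → lookupOr nothing σ i ≡ just d → target i d < k
    target-above : ∀ i d → lookupOr nothing σ i ≡ just d → lookupOr 0 xs i ≤ lookupOr 0 xs (target i d)
    target-injective : ∀ i i′ d d′ → lookupOr nothing σ i ≡ just d → lookupOr nothing σ i′ ≡ just d′ →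
      target i d ≡ target i′ d′ → i ≡ i′

Untargeted : ∀ {k} → Vec (Maybe ℕ) k → ℕ → Set
Untargeted σ p = ∀ i d → lookupOr nothing σ i ≡ just d → target i d ≢ p

openTargets-occupied : ∀ {k} (xs : Vec ℕ k) σ p {e} → openTargets xs σ ‼ p ≡ just e →
  p < k × e ≡ lookupOr 0 xs p × Untargeted σ p
openTargets-occupied [] [] p ()
openTargets-occupied (x ∷ xs) (s ∷ σ) zero refl = z<s , refl , λ i d _ → target≢0 i d
openTargets-occupied (x ∷ xs) (nothing ∷ σ) (suc p) occupied with openTargets-occupied xs σ p occupied
... | p<k , refl , untargeted = s≤s p<k , refl , λ { (suc i) d σi≡d → untargeted i d σi≡d ∘ suc-injective }
openTargets-occupied (x ∷ xs) (just d₀ ∷ σ) (suc p) occupied with d₀ ≟ⁿ p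
... | yes refl with () ← trans (sym occupied) (‼-clear (openTargets xs σ) d₀)
... | no d₀≢p with openTargets-occupied xs σ p (trans (sym (‼-[]≔-other (openTargets xs σ) d₀ p nothing d₀≢p)) occupied)
...   | p<k , refl , untargeted = s≤s p<k , refl , λ
  { zero d refl → d₀≢p ∘ suc-injective
  ; (suc i) d σi≡d → untargeted i d σi≡d ∘ suc-injective }

openTargets-untargeted : ∀ {k} (xs : Vec ℕ k) σ p → p < k → Untargeted σ p → openTargets xs σ ‼ p ≡ just (lookupOr 0 xs p)
openTargets-untargeted (x ∷ xs) (s ∷ σ) zero _ _ = refl
openTargets-untargeted (x ∷ xs) (nothing ∷ σ) (suc p) (s≤s p<k) untargeted =
  openTargets-untargeted xs σ p p<k (λ i d σi≡d → untargeted (suc i) d σi≡d ∘ cong suc)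
openTargets-untargeted (x ∷ xs) (just d₀ ∷ σ) (suc p) (s≤s p<k) untargeted =
  trans (‼-[]≔-other (openTargets xs σ) d₀ p nothing (untargeted zero d₀ refl ∘ cong suc))
        (openTargets-untargeted xs σ p p<k (λ i d σi≡d → untargeted (suc i) d σi≡d ∘ cong suc))

accepts⇒ : ∀ m x → T (accepts m x) → ∃[ e ] m ≡ just e × x ≤ e
accepts⇒ (just e) x x≤ᵇe = e , refl , to T-≤ᵇ x≤ᵇe

validᵇ⇒ValidPointers : ∀ {k} (xs : Vec ℕ k) σ → T (validᵇ xs σ) → ValidPointers xs σ
validᵇ⇒ValidPointers [] [] _ =
  record { target-in-range = λ _ _ () ; target-above = λ _ _ () ; target-injective = λ _ _ _ _ () }
validᵇ⇒ValidPointers (x ∷ xs) (s ∷ σ) valid = record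
  { target-in-range = λ { zero d s≡d → s≤s (proj₁ (head d s≡d))
                        ; (suc i) d σi≡d → s≤s (target-in-range i d σi≡d) }
  ; target-above = λ { zero d s≡d → proj₁ (proj₂ (head d s≡d))
                     ; (suc i) d σi≡d → target-above i d σi≡d }
  ; target-injective = injective
  }
  where
  valid′ = proj₁ (to T-∧ valid)
  open ValidPointers (validᵇ⇒ValidPointers xs σ valid′)
  head : ∀ d → s ≡ just d → d < _ × x ≤ lookupOr 0 xs d × Untargeted σ d
  head d refl with accepts⇒ (openTargets xs σ ‼ d) x (proj₂ (to (T-∧ {validᵇ xs σ}) valid))
  ... | e , occupied , x≤e with openTargets-occupied xs σ d occupied
  ...   | d<k , refl , untargeted = d<k , x≤e , untargeted
  injective : ∀ i i′ d d′ → lookupOr nothing (s ∷ σ) i ≡ just d → lookupOr nothing (s ∷ σ) i′ ≡ just d′ →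
    target i d ≡ target i′ d′ → i ≡ i′
  injective zero zero _ _ _ _ _ = refl
  injective zero (suc i′) d d′ s≡d σi′≡d′ same =
    ⊥-elim (proj₂ (proj₂ (head d s≡d)) i′ d′ σi′≡d′ (sym (suc-injective same)))
  injective (suc i) zero d d′ σi≡d s≡d′ same =
    ⊥-elim (proj₂ (proj₂ (head d′ s≡d′)) i d σi≡d (suc-injective same))
  injective (suc i) (suc i′) d d′ σi≡d σi′≡d′ same =
    cong suc (target-injective i i′ d d′ σi≡d σi′≡d′ (suc-injective same))

ValidPointers⇒validᵇ : ∀ {k} (xs : Vec ℕ k) σ → ValidPointers xs σ → T (validᵇ xs σ)
ValidPointers⇒validᵇ [] [] _ = _
ValidPointers⇒validᵇ (x ∷ xs) (s ∷ σ) V = from T-∧ (ValidPointers⇒validᵇ xs σ V′ , points-above s refl)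
  where
  open ValidPointers V
  V′ : ValidPointers xs σ
  V′ = record
    { target-in-range = λ i d σi≡d → ≤-pred (target-in-range (suc i) d σi≡d)
    ; target-above = λ i d σi≡d → target-above (suc i) d σi≡d
    ; target-injective = λ i i′ d d′ σi≡d σi′≡d′ same →
        suc-injective (target-injective (suc i) (suc i′) d d′ σi≡d σi′≡d′ (cong suc same))
    }
  points-above : ∀ s′ → s ≡ s′ → T (pointsAbove x s′ (openTargets xs σ))
  points-above nothing _ = _
  points-above (just d) s≡d = subst (λ m → T (accepts m x))
    (sym (openTargets-untargeted xs σ d (≤-pred (target-in-range zero d s≡d)) untargeted))
    (from T-≤ᵇ (target-above zero d s≡d))
    where
    untargeted : Untargeted σ d
    untargeted i d′ σi≡d′ target≡d = 1+n≢0 (sym (target-injective zero (suc i) d d′ s≡d σi≡d′ (cong suc (sym target≡d))))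

validᵇ⇔ValidPointers : ∀ {k} (xs : Vec ℕ k) σ → T (validᵇ xs σ) ⇔ ValidPointers xs σ
validᵇ⇔ValidPointers xs σ = mk⇔ (validᵇ⇒ValidPointers xs σ) (ValidPointers⇒validᵇ xs σ)

ΣF-is-just+unmatched : ∀ {k} (σ : Vec (Maybe ℕ) k) → ΣF k (λ a → boolToℕ (is-just (lookup σ a))) + unmatched σ ≡ k
ΣF-is-just+unmatched [] = refl
ΣF-is-just+unmatched (nothing ∷ σ) = trans (+-suc _ (unmatched σ)) (cong suc (ΣF-is-just+unmatched σ))
ΣF-is-just+unmatched (just _ ∷ σ) = cong suc (ΣF-is-just+unmatched σ)

-- Proper colourings of the inversion graph

values : ∀ {n} → Perm n → Vec ℕ n
values w = tabulate (λ i → toℕ (w ⟨$⟩ʳ i))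

T-invEdge : ∀ {n} (w : Perm n) i j → T (invEdge w i j) ⇔ (toℕ i < toℕ j × toℕ (w ⟨$⟩ʳ j) < toℕ (w ⟨$⟩ʳ i))
T-invEdge w i j = mk⇔
  (λ edge → let i<j , wj<wi = to (T-∧ {i <ᵇ j}) edge
            in toWitness {a? = i <? j} i<j , toWitness {a? = w ⟨$⟩ʳ j <? w ⟨$⟩ʳ i} wj<wi)
  (λ (i<j , wj<wi) → from (T-∧ {i <ᵇ j}) (fromWitness {a? = i <? j} i<j , fromWitness {a? = w ⟨$⟩ʳ j <? w ⟨$⟩ʳ i} wj<wi))

isProper⇔MonotoneClasses : ∀ {n t} (w : Perm n) (c : Vec (Fin t) n) → T (isProper w c) ⇔ MonotoneClasses (values w) c
isProper⇔MonotoneClasses {n} w c = mk⇔ sound complete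
  where
  value : ∀ i → lookup (values w) i ≡ toℕ (w ⟨$⟩ʳ i)
  value i = lookup∘tabulate _ i
  sound : T (isProper w c) → MonotoneClasses (values w) c
  sound proper i j i<j ci≡cj = subst₂ _≤_ (sym (value i)) (sym (value j)) (≮⇒≥ λ wj<wi →
    to T-not∨not (to T-all-allFin (to T-all-allFin proper i) j) (from (T-invEdge w i j) (i<j , wj<wi))
      (fromWitness {a? = lookup c i ≟ᶠ lookup c j} ci≡cj))
  complete : MonotoneClasses (values w) c → T (isProper w c)
  complete mono = from T-all-allFin λ i → from T-all-allFin λ j → from T-not∨not λ edge same →
    let i<j , wj<wi = to (T-invEdge w i j) edge
    in <⇒≱ wj<wi (subst₂ _≤_ (value i) (value j) (mono i j i<j (toWitness same)))

chromInv≡colourSum : ∀ {n} (w : Perm n) t → chromInv w t ≡ colourSum t (values w) (λ _ _ → 1)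
chromInv≡colourSum {n} w t = trans (length-filterᵇ (isProper w) (allVecs (allFin t) n))
  (ΣL-cong (allVecs (allFin t) n) λ c → trans
    (cong boolToℕ (T⇔T⇒≡ (⇔.trans (isProper⇔MonotoneClasses w c) (⇔.sym (monotoneClassesᵇ⇔ (values w) c)))))
    (sym (*-identityʳ _)))

-- Rook placements on the south-west diagram

module _ {n} (w : Perm n) where

  InO : Fin n → Fin n → Set
  InO a b = ∃[ j ] toℕ a < toℕ j × toℕ (w ⟨$⟩ʳ a) < toℕ (w ⟨$⟩ʳ j) × b ≡ w ⟨$⟩ʳ j

  T-inO : ∀ a b → T (inO w a b) ⇔ InO a b
  T-inO a b = mk⇔
    (λ inO → let j , cond = to T-any-allFin inO
                 a<j , rest = to (T-∧ {a <ᵇ j}) cond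
                 wa<wj , b≡wj = to (T-∧ {(w ⟨$⟩ʳ a) <ᵇ (w ⟨$⟩ʳ j)}) rest
             in j , toWitness {a? = a <? j} a<j , toWitness {a? = w ⟨$⟩ʳ a <? w ⟨$⟩ʳ j} wa<wj
                  , toWitness {a? = b ≟ᶠ w ⟨$⟩ʳ j} b≡wj)
    (λ (j , a<j , wa<wj , b≡wj) → from T-any-allFin (j , from (T-∧ {a <ᵇ j})
      (fromWitness {a? = a <? j} a<j , from (T-∧ {(w ⟨$⟩ʳ a) <ᵇ (w ⟨$⟩ʳ j)})
        (fromWitness {a? = w ⟨$⟩ʳ a <? w ⟨$⟩ʳ j} wa<wj , fromWitness {a? = b ≟ᶠ w ⟨$⟩ʳ j} b≡wj))))

  record RookPlacement (M : Board n) : Set where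
    field
      on-diagram : ∀ a b → T (cell M a b) → InO a b
      row-unique : ∀ a b b′ → T (cell M a b) → T (cell M a b′) → b ≡ b′
      column-unique : ∀ a a′ b → T (cell M a b) → T (cell M a′ b) → a ≡ a′

  T-isRookPlacement : ∀ M → T (isRookPlacement w M) ⇔ RookPlacement M
  T-isRookPlacement M = mk⇔ sound complete
    where
    sound : T (isRookPlacement w M) → RookPlacement M
    sound placement = record
      { on-diagram = λ a b rook → to (T-inO a b) (to T-⇒ (to T-all-allFin (to T-all-allFin on-O a) b) rook)
      ; row-unique = λ a b b′ rook rook′ → toWitness {a? = b ≟ᶠ b′}
          (to (attack a b a b′ rook rook′) (fromWitness {a? = a ≟ᶠ a} refl))
      ; column-unique = λ a a′ b rook rook′ → toWitness {a? = a ≟ᶠ a′}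
          (from (attack a b a′ b rook rook′) (fromWitness {a? = b ≟ᶠ b} refl))
      }
      where
      on-O = proj₁ (to (T-∧) placement)
      non-attacking = proj₂ (to (T-∧) placement)
      attack : ∀ a b a′ b′ → T (cell M a b) → T (cell M a′ b′) → T (a ≡ᵇ a′) ⇔ T (b ≡ᵇ b′)
      attack a b a′ b′ rook rook′ = to T-⇔ (to T-⇒
        (to T-all-allFin (to T-all-allFin (to T-all-allFin (to T-all-allFin non-attacking a) b) a′) b′)
        (from (T-∧ {cell M a b}) (rook , rook′)))
    complete : RookPlacement M → T (isRookPlacement w M)
    complete placement = from (T-∧)
      ( (from T-all-allFin λ a → from T-all-allFin λ b → from T-⇒ λ rook → from (T-inO a b) (on-diagram a b rook))
      , (from T-all-allFin λ a → from T-all-allFin λ b → from T-all-allFin λ a′ → from T-all-allFin λ b′ →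
          from T-⇒ λ rooks → let rook , rook′ = to (T-∧ {cell M a b}) rooks in from T-⇔ (mk⇔
            (λ a≡a′ → fromWitness {a? = b ≟ᶠ b′} (row-unique a b b′ rook
              (subst (λ a″ → T (cell M a″ b′)) (sym (toWitness {a? = a ≟ᶠ a′} a≡a′)) rook′)))
            (λ b≡b′ → fromWitness {a? = a ≟ᶠ a′} (column-unique a a′ b rook
              (subst (λ b″ → T (cell M a′ b″)) (sym (toWitness {a? = b ≟ᶠ b′} b≡b′)) rook′))))))
      where open RookPlacement placement

first : ∀ {n} → (Fin n → Bool) → Maybe (Fin n)
first {zero} h = nothing
first {suc n} h = if h zero then just zero else Maybe.map suc (first (h ∘ suc))

first-sound : ∀ {n} (h : Fin n → Bool) {j} → first h ≡ just j → T (h j)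
first-sound {suc n} h found with h zero in h₀
first-sound {suc n} h refl | true = from T-≡ h₀
... | false with first (h ∘ suc) in found′
first-sound {suc n} h refl | false | just j = first-sound (h ∘ suc) found′

first-exists : ∀ {n} (h : Fin n → Bool) j → T (h j) → ∃[ j′ ] first h ≡ just j′
first-exists {suc n} h j hj with h zero in h₀
... | true = zero , refl
first-exists {suc n} h zero hj | false with () ← trans (sym (to T-≡ hj)) h₀
first-exists {suc n} h (suc j) hj | false with first-exists (h ∘ suc) j hj
... | j′ , found = suc j′ , cong (Maybe.map suc) found

first-unique : ∀ {n} (h : Fin n → Bool) j → T (h j) → (∀ j′ → T (h j′) → j′ ≡ j) → first h ≡ just j
first-unique h j hj unique with first-exists h j hj
... | j′ , found = trans found (cong just (unique j′ (first-sound h found)))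

first-cong : ∀ {n} (h h′ : Fin n → Bool) → (∀ j → h j ≡ h′ j) → first h ≡ first h′
first-cong {zero} h h′ h≗h′ = refl
first-cong {suc n} h h′ h≗h′ rewrite h≗h′ zero =
  cong (if h′ zero then just zero else_) (cong (Maybe.map suc) (first-cong (h ∘ suc) (h′ ∘ suc) (h≗h′ ∘ suc)))

first-false : ∀ {n} → first {n} (λ _ → false) ≡ nothing
first-false {zero} = refl
first-false {suc n} = cong (Maybe.map suc) first-false

lookupOr-toℕ : ∀ {k} (x : A) (v : Vec A k) a → lookupOr x v (toℕ a) ≡ lookup v a
lookupOr-toℕ x (y ∷ v) zero = refl
lookupOr-toℕ x (y ∷ v) (suc a) = lookupOr-toℕ x v a

lookupOr-just : ∀ {k} (σ : Vec (Maybe ℕ) k) i {d} → lookupOr nothing σ i ≡ just d → ∃[ a ] toℕ a ≡ i × lookup σ a ≡ just d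
lookupOr-just (s ∷ σ) zero σ₀≡d = zero , refl , σ₀≡d
lookupOr-just (s ∷ σ) (suc i) σi≡d with lookupOr-just σ i σi≡d
... | a , a≡i , σa≡d = suc a , cong suc a≡i , σa≡d

target-distance : ∀ a j → a < j → target a (j ∸ suc a) ≡ j
target-distance a j a<j = trans (+-suc a _) (m+[n∸m]≡n a<j)

distance-target : ∀ a d → target a d ∸ suc a ≡ d
distance-target a d = trans (cong (_∸ suc a) (+-suc a d)) (m+n∸m≡n a d)

vec-ext : ∀ {k} {u v : Vec A k} → (∀ i → lookup u i ≡ lookup v i) → u ≡ v
vec-ext {u = u} {v} u≗v = trans (sym (tabulate∘lookup u)) (trans (tabulate-cong u≗v) (tabulate∘lookup v))

pointsAt : Maybe ℕ → ℕ → ℕ → Bool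
pointsAt nothing a j = false
pointsAt (just d) a j = ⌊ target a d ≟ⁿ j ⌋

T-pointsAt : ∀ m a j → T (pointsAt m a j) → ∃[ d ] m ≡ just d × target a d ≡ j
T-pointsAt (just d) a j hit = d , refl , toWitness hit

module _ {n} (w : Perm n) where

  private
    w-injective : ∀ {i j} → w ⟨$⟩ʳ i ≡ w ⟨$⟩ʳ j → i ≡ j
    w-injective = Injection.injective (↔⇒↣ w)

    value : ∀ a → lookupOr 0 (values w) (toℕ a) ≡ toℕ (w ⟨$⟩ʳ a)
    value a = trans (lookupOr-toℕ 0 (values w) a) (lookup∘tabulate _ a)

  offset : Fin n → Fin n → ℕ
  offset a j = toℕ j ∸ suc (toℕ a)

  rookRow : Board n → Fin n → Fin n → Bool
  rookRow M a j = cell M a (w ⟨$⟩ʳ j)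

  toPointers : Board n → Vec (Maybe ℕ) n
  toPointers M = tabulate λ a → Maybe.map (offset a) (first (rookRow M a))

  toBoard : Vec (Maybe ℕ) n → Board n
  toBoard σ = tabulate λ a → tabulate λ b → pointsAt (lookup σ a) (toℕ a) (toℕ (w ⟨$⟩ˡ b))

  cell-toBoard : ∀ σ a b → cell (toBoard σ) a b ≡ pointsAt (lookup σ a) (toℕ a) (toℕ (w ⟨$⟩ˡ b))
  cell-toBoard σ a b = trans (cong (λ row → lookup row b) (lookup∘tabulate _ a)) (lookup∘tabulate _ b)

  lookup-toPointers : ∀ M a → lookup (toPointers M) a ≡ Maybe.map (offset a) (first (rookRow M a))
  lookup-toPointers M a = lookup∘tabulate _ a

  first-rook : ∀ M → RookPlacement w M → ∀ a {j} → first (rookRow M a) ≡ just j →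
    T (cell M a (w ⟨$⟩ʳ j)) × toℕ a < toℕ j × toℕ (w ⟨$⟩ʳ a) < toℕ (w ⟨$⟩ʳ j)
  first-rook M placement a found with first-sound (rookRow M a) found
  ... | rook with RookPlacement.on-diagram placement a _ rook
  ...   | j , a<j , wa<wj , wj′≡wj with w-injective wj′≡wj
  ...     | refl = rook , a<j , wa<wj

  toBoard-toPointers : ∀ M → RookPlacement w M → toBoard (toPointers M) ≡ M
  toBoard-toPointers M placement = vec-ext λ a → vec-ext λ b → trans (cell-toBoard (toPointers M) a b)
    (trans (cong (λ m → pointsAt m (toℕ a) (toℕ (w ⟨$⟩ˡ b))) (lookup-toPointers M a)) (T⇔T⇒≡ (same-cell a b)))
    where
    open RookPlacement placement
    same-cell : ∀ a b → T (pointsAt (Maybe.map (offset a) (first (rookRow M a))) (toℕ a) (toℕ (w ⟨$⟩ˡ b))) ⇔ T (cell M a b)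
    same-cell a b with first (rookRow M a) in found
    ... | nothing = mk⇔ (λ ()) λ rook →
      let _ , found′ = first-exists (rookRow M a) (w ⟨$⟩ˡ b) (subst (T ∘ cell M a) (sym (inverseʳ w)) rook)
      in case trans (sym found) found′ of λ ()
    ... | just j = mk⇔
      (λ hit → subst (T ∘ cell M a)
         (trans (cong (w ⟨$⟩ʳ_) (toℕ-injective (trans (sym (target-distance (toℕ a) (toℕ j) a<j)) (toWitness hit))))
                (inverseʳ w))
         rook′)
      (λ rook → fromWitness (trans (target-distance (toℕ a) (toℕ j) a<j)
                  (cong toℕ (w-injective (trans (row-unique a _ b rook′ rook) (sym (inverseʳ w)))))))
      where
      rook′ = proj₁ (first-rook M placement a found)
      a<j = proj₁ (proj₂ (first-rook M placement a found))

  pointer-row : ∀ (a : Fin n) m → (∀ d → m ≡ just d → target (toℕ a) d < n) →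
    Maybe.map (offset a) (first (λ j → pointsAt m (toℕ a) (toℕ j))) ≡ m
  pointer-row a nothing _ = cong (Maybe.map (offset a)) first-false
  pointer-row a (just d) in-range = trans (cong (Maybe.map (offset a)) found)
    (cong just (trans (cong (_∸ suc (toℕ a)) (toℕ-fromℕ< t<n)) (distance-target (toℕ a) d)))
    where
    t<n = in-range d refl
    found : first (λ j → pointsAt (just d) (toℕ a) (toℕ j)) ≡ just (fromℕ< t<n)
    found = first-unique _ (fromℕ< t<n) (fromWitness (sym (toℕ-fromℕ< t<n)))
      (λ j hit → toℕ-injective (trans (sym (toWitness hit)) (sym (toℕ-fromℕ< t<n))))

  toPointers-toBoard : ∀ σ → ValidPointers (values w) σ → toPointers (toBoard σ) ≡ σ
  toPointers-toBoard σ valid = vec-ext λ a → trans (lookup-toPointers (toBoard σ) a)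
    (trans (cong (Maybe.map (offset a)) (first-cong (rookRow (toBoard σ) a) _ λ j →
              trans (cell-toBoard σ a (w ⟨$⟩ʳ j)) (cong (λ j′ → pointsAt (lookup σ a) (toℕ a) (toℕ j′)) (inverseˡ w))))
           (pointer-row a (lookup σ a) (λ d σa≡d → target-in-range (toℕ a) d (trans (lookupOr-toℕ nothing σ a) σa≡d))))
    where open ValidPointers valid

  toPointers-valid : ∀ M → RookPlacement w M → ValidPointers (values w) (toPointers M)
  toPointers-valid M placement = record
    { target-in-range = in-range
    ; target-above = above
    ; target-injective = injective
    }
    where
    open RookPlacement placement
    rook-of : ∀ i d → lookupOr nothing (toPointers M) i ≡ just d →
      ∃[ a ] ∃[ j ] toℕ a ≡ i × target (toℕ a) d ≡ toℕ j × T (cell M a (w ⟨$⟩ʳ j))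
                    × toℕ (w ⟨$⟩ʳ a) < toℕ (w ⟨$⟩ʳ j)
    rook-of i d σi≡d with lookupOr-just (toPointers M) i σi≡d
    ... | a , a≡i , σa≡d with first (rookRow M a) in found | trans (sym (lookup-toPointers M a)) σa≡d
    ... | just j | refl with first-rook M placement a found
    ...   | rook , a<j , wa<wj = a , j , a≡i , target-distance (toℕ a) (toℕ j) a<j , rook , wa<wj
    in-range : ∀ i d → lookupOr nothing (toPointers M) i ≡ just d → target i d < n
    in-range i d σi≡d with rook-of i d σi≡d
    ... | a , j , refl , hit , _ = subst (_< n) (sym hit) (toℕ<n j)
    above : ∀ i d → lookupOr nothing (toPointers M) i ≡ just d → lookupOr 0 (values w) i ≤ lookupOr 0 (values w) (target i d)
    above i d σi≡d with rook-of i d σi≡d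
    ... | a , j , refl , hit , _ , wa<wj =
      subst₂ _≤_ (sym (value a)) (sym (trans (cong (lookupOr 0 (values w)) hit) (value j))) (<⇒≤ wa<wj)
    injective : ∀ i i′ d d′ → lookupOr nothing (toPointers M) i ≡ just d → lookupOr nothing (toPointers M) i′ ≡ just d′ →
      target i d ≡ target i′ d′ → i ≡ i′
    injective i i′ d d′ σi≡d σi′≡d′ same with rook-of i d σi≡d | rook-of i′ d′ σi′≡d′
    ... | a , j , refl , hit , rook , _ | a′ , j′ , refl , hit′ , rook′ , _
      with toℕ-injective (trans (sym hit) (trans same hit′))
    ...   | refl = cong toℕ (column-unique a a′ _ rook rook′)

  toBoard-rookPlacement : ∀ σ → ValidPointers (values w) σ → RookPlacement w (toBoard σ)
  toBoard-rookPlacement σ valid = record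
    { on-diagram = on-diagram
    ; row-unique = row-unique
    ; column-unique = column-unique
    }
    where
    open ValidPointers valid
    pointer-of : ∀ a b → T (cell (toBoard σ) a b) → ∃[ d ] lookup σ a ≡ just d × target (toℕ a) d ≡ toℕ (w ⟨$⟩ˡ b)
    pointer-of a b rook = T-pointsAt (lookup σ a) (toℕ a) _ (subst T (cell-toBoard σ a b) rook)
    σ-at : ∀ a {d} → lookup σ a ≡ just d → lookupOr nothing σ (toℕ a) ≡ just d
    σ-at a = trans (lookupOr-toℕ nothing σ a)
    on-diagram : ∀ a b → T (cell (toBoard σ) a b) → InO w a b
    on-diagram a b rook with pointer-of a b rook
    ... | d , σa≡d , hit =
      j , a<j , ≤∧≢⇒< wa≤wj (λ wa≡wj → <-irrefl (cong toℕ (w-injective (toℕ-injective wa≡wj))) a<j) , sym (inverseʳ w)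
      where
      j = w ⟨$⟩ˡ b
      a<j : toℕ a < toℕ j
      a<j = subst (toℕ a <_) hit (m<m+n (toℕ a) (s≤s z≤n))
      wa≤wj : toℕ (w ⟨$⟩ʳ a) ≤ toℕ (w ⟨$⟩ʳ j)
      wa≤wj = subst₂ _≤_ (value a) (trans (cong (lookupOr 0 (values w)) hit) (value j)) (target-above (toℕ a) d (σ-at a σa≡d))
    row-unique : ∀ a b b′ → T (cell (toBoard σ) a b) → T (cell (toBoard σ) a b′) → b ≡ b′
    row-unique a b b′ rook rook′ with pointer-of a b rook | pointer-of a b′ rook′
    ... | d , σa≡d , hit | d′ , σa≡d′ , hit′ with trans (sym σa≡d) σa≡d′
    ...   | refl = trans (sym (inverseʳ w)) (trans (cong (w ⟨$⟩ʳ_) (toℕ-injective (trans (sym hit) hit′))) (inverseʳ w))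
    column-unique : ∀ a a′ b → T (cell (toBoard σ) a b) → T (cell (toBoard σ) a′ b) → a ≡ a′
    column-unique a a′ b rook rook′ with pointer-of a b rook | pointer-of a′ b rook′
    ... | d , σa≡d , hit | d′ , σa′≡d′ , hit′ =
      toℕ-injective (target-injective (toℕ a) (toℕ a′) d d′ (σ-at a σa≡d) (σ-at a′ σa′≡d′) (trans hit (sym hit′)))

  ΣL-reindex : ∀ (F : Fin n → ℕ) → ΣL (allFin n) (λ b → F (w ⟨$⟩ˡ b)) ≡ ΣL (allFin n) F
  ΣL-reindex F = ΣL-bijection _≟ᶠ_ _≟ᶠ_ (allFin n) (allFin n) (F ∘ (w ⟨$⟩ˡ_)) F (w ⟨$⟩ˡ_) (w ⟨$⟩ʳ_)
    (λ b _ → multiplicity-allFin n b) (λ j _ → multiplicity-allFin n j)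
    (λ _ _ → inverseʳ w) (λ _ _ → refl) (λ _ _ → inverseˡ w) (λ _ _ → cong F (inverseˡ w))

  rooks-in-row : ∀ (a : Fin n) m → (∀ d → m ≡ just d → target (toℕ a) d < n) →
    ΣL (allFin n) (λ j → boolToℕ (pointsAt m (toℕ a) (toℕ j))) ≡ boolToℕ (is-just m)
  rooks-in-row a nothing _ = ΣL-zero (allFin n) (λ _ → refl)
  rooks-in-row a (just d) in-range = trans
    (ΣL-cong (allFin n) λ j → 𝟙-cong (mk⇔ (λ hit → toℕ-injective (trans (sym hit) (sym (toℕ-fromℕ< t<n))))
                                          (λ { refl → sym (toℕ-fromℕ< t<n) }))
                                     (target (toℕ a) d ≟ⁿ toℕ j) (j ≟ᶠ fromℕ< t<n))
    (multiplicity-allFin n (fromℕ< t<n))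
    where t<n = in-range d refl

  size-toBoard : ∀ σ → ValidPointers (values w) σ → size (toBoard σ) ≡ ΣF n (λ a → boolToℕ (is-just (lookup σ a)))
  size-toBoard σ valid = trans (ΣL-cong (allFin n) row-size) (ΣL-allFin n _)
    where
    open ValidPointers valid
    row-size : ∀ a → ΣL (allFin n) (λ b → boolToℕ (cell (toBoard σ) a b)) ≡ boolToℕ (is-just (lookup σ a))
    row-size a = begin
      ΣL (allFin n) (λ b → boolToℕ (cell (toBoard σ) a b))
        ≡⟨ ΣL-cong (allFin n) (λ b → cong boolToℕ (cell-toBoard σ a b)) ⟩
      ΣL (allFin n) (λ b → boolToℕ (pointsAt (lookup σ a) (toℕ a) (toℕ (w ⟨$⟩ˡ b))))
        ≡⟨ ΣL-reindex (λ j → boolToℕ (pointsAt (lookup σ a) (toℕ a) (toℕ j))) ⟩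
      ΣL (allFin n) (λ j → boolToℕ (pointsAt (lookup σ a) (toℕ a) (toℕ j)))
        ≡⟨ rooks-in-row a (lookup σ a) (λ d σa≡d → target-in-range (toℕ a) d (trans (lookupOr-toℕ nothing σ a) σa≡d)) ⟩
      boolToℕ (is-just (lookup σ a)) ∎
      where open ≡-Reasoning

boards : ∀ n → List (Board n)
boards n = allVecs (allVecs (true ∷ false ∷ []) n) n

module _ {n} (w : Perm n) (t : ℕ) where

  rookWeight : Board n → ℕ
  rookWeight M = boolToℕ (isRookPlacement w M) * fall t (n ∸ size M)

  pointerWeight : Vec (Maybe ℕ) n → ℕ
  pointerWeight σ = boolToℕ (validᵇ (values w) σ) * (fall t (unmatched σ) * 1)

  unmatched≡n∸size : ∀ σ → ValidPointers (values w) σ → unmatched σ ≡ n ∸ size (toBoard w σ)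
  unmatched≡n∸size σ valid = sym (begin
    n ∸ size (toBoard w σ)      ≡⟨ cong (n ∸_) (size-toBoard w σ valid) ⟩
    n ∸ matched                 ≡⟨ cong (_∸ matched) (sym (ΣF-is-just+unmatched σ)) ⟩
    matched + unmatched σ ∸ matched ≡⟨ m+n∸m≡n matched (unmatched σ) ⟩
    unmatched σ                 ∎)
    where
    open ≡-Reasoning
    matched = ΣF n (λ a → boolToℕ (is-just (lookup σ a)))

  size-rookPlacement : ∀ M → RookPlacement w M → size M ≤ n
  size-rookPlacement M placement = begin
    size M                            ≡⟨ cong size (sym (toBoard-toPointers w M placement)) ⟩
    size (toBoard w σ)                ≡⟨ size-toBoard w σ (toPointers-valid w M placement) ⟩
    matched                           ≤⟨ m≤m+n matched (unmatched σ) ⟩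
    matched + unmatched σ             ≡⟨ ΣF-is-just+unmatched σ ⟩
    n                                 ∎
    where
    open ≤-Reasoning
    σ = toPointers w M
    matched = ΣF n (λ a → boolToℕ (is-just (lookup σ a)))

  weights-agree : ∀ {a b x y} → T a → T b → x ≡ y → boolToℕ a * (fall t x * 1) ≡ boolToℕ b * fall t y
  weights-agree {true} {true} _ _ x≡y = cong (_+ 0) (trans (*-identityʳ _) (cong (fall t) x≡y))

  pointerSum≡Σ-rookWeight : pointerSum n t (values w) (λ _ _ → 1) ≡ ΣL (boards n) rookWeight
  pointerSum≡Σ-rookWeight = sym (ΣL-bijection (≡-decᵛ (≡-decᵛ _≟ᵇ_)) (≡-decᵛ _≟ᵐ_)
    (boards n) (allVecs (pointers n) n) rookWeight pointerWeight (toPointers w) (toBoard w)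
    (λ M _ → board-once M) pointers-once
    (λ M ≢0 → toBoard-toPointers w M (placement M ≢0)) weight-toPointers
    (λ σ ≢0 → toPointers-toBoard w σ (valid σ ≢0)) weight-toBoard)
    where
    placement : ∀ M → rookWeight M ≢ 0 → RookPlacement w M
    placement M = to (T-isRookPlacement w M) ∘ boolToℕ*≢0⇒T (isRookPlacement w M)
    valid : ∀ σ → pointerWeight σ ≢ 0 → ValidPointers (values w) σ
    valid σ = to (validᵇ⇔ValidPointers _ _) ∘ boolToℕ*≢0⇒T (validᵇ (values w) σ)
    board-once : ∀ M → multiplicity (≡-decᵛ (≡-decᵛ _≟ᵇ_)) (boards n) M ≡ 1
    board-once M = multiplicity-allVecs _ _ (λ _ → ⊤)
      (λ row _ → multiplicity-allVecs _ _ (λ _ → ⊤) (λ b _ → multiplicity-bools b) n row (universal _ row)) n M (universal _ M)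
    pointers-once : ∀ σ → pointerWeight σ ≢ 0 → multiplicity (≡-decᵛ _≟ᵐ_) (allVecs (pointers n) n) σ ≡ 1
    pointers-once σ ≢0 = multiplicity-allVecs _ _ (MaybeAll.All (_< n)) (multiplicity-pointers n) n σ
      (lookup⁻ λ a → in-range a (lookup σ a) refl)
      where
      open ValidPointers (valid σ ≢0)
      in-range : ∀ a m → lookup σ a ≡ m → MaybeAll.All (_< n) m
      in-range a nothing _ = MaybeAll.nothing
      in-range a (just d) σa≡d = MaybeAll.just (≤-trans (m≤n+m (suc d) (toℕ a))
        (<⇒≤ (target-in-range (toℕ a) d (trans (lookupOr-toℕ nothing σ a) σa≡d))))
    weight-toPointers : ∀ M → rookWeight M ≢ 0 → pointerWeight (toPointers w M) ≡ rookWeight M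
    weight-toPointers M ≢0 = weights-agree (from (validᵇ⇔ValidPointers _ _) valid′) (from (T-isRookPlacement w M) (placement M ≢0))
      (trans (unmatched≡n∸size _ valid′) (cong (λ M′ → n ∸ size M′) (toBoard-toPointers w M (placement M ≢0))))
      where valid′ = toPointers-valid w M (placement M ≢0)
    weight-toBoard : ∀ σ → pointerWeight σ ≢ 0 → rookWeight (toBoard w σ) ≡ pointerWeight σ
    weight-toBoard σ ≢0 = sym (weights-agree (from (validᵇ⇔ValidPointers _ _) (valid σ ≢0))
      (from (T-isRookPlacement w _) (toBoard-rookPlacement w σ (valid σ ≢0))) (unmatched≡n∸size σ (valid σ ≢0)))

  Σ-size-classes : ∀ M → sumTo n (λ i → boolToℕ (isRookPlacement w M ∧ ⌊ size M ≟ⁿ n ∸ i ⌋) * fall t i) ≡ rookWeight M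
  Σ-size-classes M with isRookPlacement w M in rp
  ... | false = sumTo-zero n _ (λ _ _ → refl)
  ... | true = trans (sumTo-single n _ (n ∸ size M) (m∸n≤m n (size M)) other-sizes) own-size
    where
    size≤n : size M ≤ n
    size≤n = size-rookPlacement M (to (T-isRookPlacement w M) (from T-≡ rp))
    own-size : boolToℕ ⌊ size M ≟ⁿ n ∸ (n ∸ size M) ⌋ * fall t (n ∸ size M) ≡ 1 * fall t (n ∸ size M)
    own-size with size M ≟ⁿ n ∸ (n ∸ size M)
    ... | yes _ = refl
    ... | no size≢ = ⊥-elim (size≢ (sym (m∸[m∸n]≡n size≤n)))
    other-sizes : ∀ i → i ≤ n → i ≢ n ∸ size M → boolToℕ ⌊ size M ≟ⁿ n ∸ i ⌋ * fall t i ≡ 0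
    other-sizes i i≤n i≢n∸size with size M ≟ⁿ n ∸ i
    ... | no _ = refl
    ... | yes size≡n∸i = ⊥-elim (i≢n∸size (trans (sym (m∸[m∸n]≡n i≤n)) (cong (n ∸_) (sym size≡n∸i))))

  sumTo-rook≡Σ-rookWeight : sumTo n (λ i → rook w (n ∸ i) * fall t i) ≡ ΣL (boards n) rookWeight
  sumTo-rook≡Σ-rookWeight = begin
    sumTo n (λ i → rook w (n ∸ i) * fall t i)
      ≡⟨ sumTo-cong n (λ i → trans (cong (_* fall t i) (length-filterᵇ _ (boards n))) (sym (ΣL-*ʳ (boards n) (fall t i) _))) ⟩
    sumTo n (λ i → ΣL (boards n) (λ M → boolToℕ (isRookPlacement w M ∧ ⌊ size M ≟ⁿ n ∸ i ⌋) * fall t i))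
      ≡⟨ sumTo-ΣL n (boards n) _ ⟩
    ΣL (boards n) (λ M → sumTo n (λ i → boolToℕ (isRookPlacement w M ∧ ⌊ size M ≟ⁿ n ∸ i ⌋) * fall t i))
      ≡⟨ ΣL-cong (boards n) Σ-size-classes ⟩
    ΣL (boards n) rookWeight ∎
    where open ≡-Reasoning

theoremA1 : (n : ℕ) (w : Perm n) (t : ℕ) →
    chromInv w t ≡ sumTo n (λ i → rook w (n ∸ i) * fall t i)
theoremA1 n w t = begin
  chromInv w t                                    ≡⟨ chromInv≡colourSum w t ⟩
  colourSum t (values w) (λ _ _ → 1)              ≡⟨ colourSum≡pointerSum n t (values w) ≤-refl (λ _ _ → 1) (λ _ _ → refl) ⟩
  pointerSum n t (values w) (λ _ _ → 1)           ≡⟨ pointerSum≡Σ-rookWeight w t ⟩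
  ΣL (boards n) (rookWeight w t)                  ≡⟨ sym (sumTo-rook≡Σ-rookWeight w t) ⟩
  sumTo n (λ i → rook w (n ∸ i) * fall t i)       ∎
  where open ≡-Reasoning
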